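{- Let $d,\delta,\alpha$ be positive integers with $d/2\ge\delta>\alpha$. Consider the following algorithm on an initially empty dynamic graph $G$ on $n$ vertices undergoing a sequence $\sigma$ of edge insertions and deletions such that the arboricity of $G$ is at most $\alpha$ at all times. It maintains, for each vertex, the list of its out-edges of an orientation of $G$. On deletion of an edge, the edge is found in the out-lists of its endpoints and removed. On insertion of an edge $e$, an arbitrary endpoint $u$ of $e$ is chosen, $e$ is added to the out-list of $u$, and then every out-edge of $u$ (including $e$) is reversed; afterwards, as long as some vertex $v$ has out-degree larger than $d$, all out-edges of $v$ are reversed. Then this algorithm has amortized insertion cost $O\!\left(\delta\cdot\frac{d+1}{d+1-2\delta}\right)$ and amortized deletion cost $O\!\left(d+\log_{\delta/\alpha}(n)\cdot\frac{d+1}{d+1-2\delta}\right)$.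
   Context: The arboricity of a graph is the minimum number of forests into which its edge set can be partitioned. -}

module Defs where

open import Data.Nat using (ℕ; zero; suc; _+_; _*_; _<_; _≤_)
open import Data.Bool using (Bool; true; false; _∧_; _∨_; not; if_then_else_)
open import Data.Fin using (Fin; zero; suc; inject₁; fromℕ; _≟_)
open import Data.List using (List; []; _∷_; length; filterᵇ)
open import Data.Bool.ListAction using (any)
open import Data.Product using (Σ; _×_; _,_)
open import Data.Sum using (_⊎_)
open import Relation.Nullary using (¬_)
open import Relation.Nullary.Decidable using (⌊_⌋)
open import Relation.Binary.PropositionalEquality using (_≡_; _≢_)
open import Function.Definitions using (Injective)

-- Graphs on the vertex set Fin n, given by a (symmetric) Boolean
-- adjacency function.

Graph : ℕ → Set
Graph n = Fin n → Fin n → Bool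

_==_ : ∀ {n} → Fin n → Fin n → Bool
x == y = ⌊ x ≟ y ⌋

isEdge : ∀ {n} → Fin n → Fin n → Fin n → Fin n → Bool
isEdge u v x y = ((x == u) ∧ (y == v)) ∨ ((x == v) ∧ (y == u))

record Cycle {n : ℕ} (H : Fin n → Fin n → Set) : Set where
  field
    k     : ℕ
    vs    : Fin (suc (suc (suc k))) → Fin n
    inj   : Injective _≡_ _≡_ vs
    adj   : (i : Fin (suc (suc k))) → H (vs (inject₁ i)) (vs (suc i))
    close : H (vs (fromℕ (suc (suc k)))) (vs zero)

-- Arboricity at most α: the edge set can be partitioned into α forests,
-- i.e. there is an edge colouring with α colours (a colour is assigned
-- to each unordered pair) every colour class of which has no cycle.
ArboricityAtMost : ∀ {n} → ℕ → Graph n → Set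
ArboricityAtMost {n} α G =
  Σ (Fin n → Fin n → Fin α) λ col →
    ((x y : Fin n) → col x y ≡ col y x) ×
    ((c : Fin α) → ¬ Cycle (λ x y → (G x y ≡ true) × (col x y ≡ c)))

-- Update sequences, stored as snoc-lists (the last operation is outermost).

data Op (n : ℕ) : Set where
  ins : Fin n → Fin n → Op n
  del : Fin n → Fin n → Op n

data Seq (n : ℕ) : Set where
  []  : Seq n
  _▷_ : Seq n → Op n → Seq n

infixl 5 _▷_

graphOf : ∀ {n} → Seq n → Graph n
graphOf [] x y = false
graphOf (ρ ▷ ins u v) x y = isEdge u v x y ∨ graphOf ρ x y
graphOf (ρ ▷ del u v) x y = not (isEdge u v x y) ∧ graphOf ρ x y

data Valid {n : ℕ} (α : ℕ) : Seq n → Set where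
  []  : Valid α []
  ins : ∀ {ρ u v} → Valid α ρ → u ≢ v → graphOf ρ u v ≡ false →
        ArboricityAtMost α (graphOf (ρ ▷ ins u v)) → Valid α (ρ ▷ ins u v)
  del : ∀ {ρ u v} → Valid α ρ → graphOf ρ u v ≡ true →
        ArboricityAtMost α (graphOf (ρ ▷ del u v)) → Valid α (ρ ▷ del u v)

#ins : ∀ {n} → Seq n → ℕ
#ins [] = 0
#ins (ρ ▷ ins _ _) = suc (#ins ρ)
#ins (ρ ▷ del _ _) = #ins ρ

#del : ∀ {n} → Seq n → ℕ
#del [] = 0
#del (ρ ▷ ins _ _) = #del ρ
#del (ρ ▷ del _ _) = suc (#del ρ)

-- The algorithm.  State: for every vertex, the list of heads of its
-- out-edges.

Out : ℕ → Set
Out n = Fin n → List (Fin n)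

emptyOut : ∀ {n} → Out n
emptyOut _ = []

mem : ∀ {n} → Fin n → List (Fin n) → Bool
mem w = any (λ y → w == y)

addOut : ∀ {n} → Out n → Fin n → Fin n → Out n
addOut s u v w = if w == u then v ∷ s w else s w

reverseAll : ∀ {n} → Out n → Fin n → Out n
reverseAll s u w =
  if w == u then [] else (if mem w (s u) then u ∷ s w else s w)

removeArc : ∀ {n} → Out n → Fin n → Fin n → Out n
removeArc s u v w = if w == u then filterᵇ (λ y → not (y == v)) (s w) else s w

deleteEdge : ∀ {n} → Out n → Fin n → Fin n → Out n
deleteEdge s u v = removeArc (removeArc s u v) v u

Endpoints : ∀ {n} → Fin n → Fin n → Fin n → Fin n → Set
Endpoints u v x y = ((x ≡ u) × (y ≡ v)) ⊎ ((x ≡ v) × (y ≡ u))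

-- a (possibly unfinished) run of the repair loop "while some v has
-- out-degree > d, reverse all out-edges of v", with its cost (number of
-- reversed edges); the violating vertex is chosen arbitrarily
data Flips {n : ℕ} (d : ℕ) : Out n → Out n → ℕ → Set where
  done : ∀ {s} → Flips d s s 0
  step : ∀ {s s' c} (v : Fin n) → d < length (s v) →
         Flips d (reverseAll s v) s' c → Flips d s s' (length (s v) + c)

Settled : ∀ {n} → ℕ → Out n → Set
Settled d s = ∀ w → length (s w) ≤ d

-- Cost model: an insertion costs 1 + number of reversed edges (the
-- initial reversal of the out-edges of x, including the new edge, plus
-- all reversals of the loop); a deletion costs 1 + the lengths of the
-- two out-lists searched.
insStartCost : ∀ {n} → Out n → Fin n → ℕ
insStartCost s x = 1 + suc (length (s x))

delCost : ∀ {n} → Out n → Fin n → Fin n → ℕ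
delCost s u v = 1 + length (s u) + length (s v)

data Run {n : ℕ} (d : ℕ) : Seq n → Out n → ℕ → Set where
  start : Run d [] emptyOut 0
  ins   : ∀ {ρ s c s' c' u v} (x y : Fin n) → Run d ρ s c → Endpoints u v x y →
          Flips d (reverseAll (addOut s x y) x) s' c' → Settled d s' →
          Run d (ρ ▷ ins u v) s' (c + (insStartCost s x + c'))
  del   : ∀ {ρ s c u v} → Run d ρ s c →
          Run d (ρ ▷ del u v) (deleteEdge s u v) (c + delCost s u v)

-- runs that may be stopped in the middle of the repair loop of the last
-- insertion (so that the bound also covers non-terminating behaviour)
data PartialRun {n : ℕ} (d : ℕ) : Seq n → Out n → ℕ → Set where
  full  : ∀ {σ s c} → Run d σ s c → PartialRun d σ s c
  inIns : ∀ {ρ s c s' c' u v} (x y : Fin n) → Run d ρ s c → Endpoints u v x y →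
          Flips d (reverseAll (addOut s x y) x) s' c' →
          PartialRun d (ρ ▷ ins u v) s' (c + (insStartCost s x + c'))

-- Fix an orientation O of the current graph with all out-degrees at most δ and
-- take as potential d + 1 times the number of arcs of the maintained orientation
-- that O orients the other way.  When the repair loop reverses a vertex of
-- out-degree at least d + 1, at most δ of its arcs agree with O, so the potential
-- drops by at least (d + 1)(d + 1 − 2δ), which pays d + 1 − 2δ for every
-- reversed arc; the first reversal of an insertion raises it by O(δ (d + 1)).
-- Changing the graph also forces O to change.  After inserting uv, a good
-- orientation is obtained from the old one by adding u → v and reversing a single
-- path from u of length at most L = log_{δ/α} n: as long as all vertices reachable
-- from u within i steps have out-degree δ, these sets grow by a factor δ/α,
-- because a graph of arboricity α has fewer than α |T| edges inside any vertex
-- set T.  A deletion of uv is handled by the same argument applied to the graph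
-- without uv, so O moves by at most L arcs and the potential by at most L (d + 1).

module Submission where

open import Defs
open import Data.Bool using (Bool; true; false; _∧_; _∨_; not; if_then_else_)
open import Data.Bool.Properties using (∨-comm; ∧-comm; ∨-identityʳ; ∧-identityʳ; ∧-zeroʳ) renaming (_≟_ to _≟ᵇ_)
open import Data.Empty using (⊥; ⊥-elim)
open import Data.Fin using (Fin; zero; suc; toℕ; inject₁; fromℕ; _≟_)
open import Data.Fin.Properties using (any?; toℕ-injective; toℕ<n; toℕ-fromℕ; toℕ-inject₁; injective⇒≤)
open import Data.List using (List; []; _∷_; length; filterᵇ)
open import Data.Nat using (ℕ; zero; suc; _+_; _*_; _∸_; _^_; _<_; _≤_; z≤n; s≤s; z<s; _≤?_; _<?_; NonZero; >-nonZero)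
open import Data.Nat.Properties hiding (_≟_)
open import Data.Nat.Tactic.RingSolver using (solve-∀)
open import Data.Product using (Σ; ∃; _×_; _,_; proj₁; proj₂)
open import Data.Sum using (_⊎_; inj₁; inj₂; [_,_]′)
open import Data.Unit using (⊤; tt)
open import Function.Definitions using (Injective)
open import Relation.Binary.Definitions using (Tri; tri<; tri≈; tri>)
open import Relation.Binary.PropositionalEquality
open import Relation.Nullary using (¬_; yes; no)
open import Relation.Nullary.Decidable using (_×-dec_; ¬?)
open import Algebra.Properties.CommutativeSemigroup *-commutativeSemigroup using (x∙yz≈y∙xz)
open import Algebra.Properties.Semiring.Sum +-*-semiring
  using (sum; ∑-distrib-+; ∑-comm; sum-cong-≗; *-distribˡ-sum; sum-replicate-zero)

ind : Bool → ℕ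
ind true = 1
ind false = 0

ind≤1 : ∀ b → ind b ≤ 1
ind≤1 true = ≤-refl
ind≤1 false = z≤n

ind-∧ : ∀ a b → ind (a ∧ b) ≡ ind a * ind b
ind-∧ true b = sym (+-identityʳ _)
ind-∧ false b = refl

∧-true : ∀ {a b} → a ∧ b ≡ true → (a ≡ true) × (b ≡ true)
∧-true {true} {true} _ = refl , refl

∨-true : ∀ {a b} → a ∨ b ≡ true → (a ≡ true) ⊎ (b ≡ true)
∨-true {true} _ = inj₁ refl
∨-true {false} e = inj₂ e

true≢false : ∀ {b} → b ≡ true → b ≢ false
true≢false refl ()

==-refl : ∀ {n} (x : Fin n) → x == x ≡ true
==-refl x with x ≟ x
... | yes _ = refl
... | no x≢x = ⊥-elim (x≢x refl)

==⇒≡ : ∀ {n} {x y : Fin n} → x == y ≡ true → x ≡ y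
==⇒≡ {x = x} {y} e with x ≟ y
... | yes x≡y = x≡y
==⇒≡ {x = x} {y} () | no _

≢⇒==false : ∀ {n} {x y : Fin n} → x ≢ y → x == y ≡ false
≢⇒==false {x = x} {y} x≢y with x ≟ y
... | yes x≡y = ⊥-elim (x≢y x≡y)
... | no _ = refl

-- Case analysis through this function, unlike `with x ≟ y`, leaves the `x == y` occurring in goals alone.
≡-or-≢ : ∀ {n} (x y : Fin n) → (x ≡ y) ⊎ (x ≢ y)
≡-or-≢ x y with x ≟ y
... | yes x≡y = inj₁ x≡y
... | no x≢y = inj₂ x≢y

==-sym : ∀ {n} (x y : Fin n) → x == y ≡ y == x
==-sym x y with x ≟ y | y ≟ x
... | yes _ | yes _ = refl
... | no _ | no _ = refl
... | yes x≡y | no y≢x = ⊥-elim (y≢x (sym x≡y))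
... | no x≢y | yes y≡x = ⊥-elim (x≢y (sym y≡x))

==-suc : ∀ {n} (x y : Fin n) → (suc x == suc y) ≡ (x == y)
==-suc x y with x ≟ y
... | yes _ = refl
... | no _ = refl

sum-mono-≤ : ∀ {n} {f g : Fin n → ℕ} → (∀ i → f i ≤ g i) → sum f ≤ sum g
sum-mono-≤ {zero} f≤g = z≤n
sum-mono-≤ {suc n} f≤g = +-mono-≤ (f≤g zero) (sum-mono-≤ (λ i → f≤g (suc i)))

sum-const : ∀ {n} (k : ℕ) → sum {n} (λ _ → k) ≡ n * k
sum-const {zero} k = refl
sum-const {suc n} k = cong (k +_) (sum-const {n} k)

term≤sum : ∀ {n} (f : Fin n → ℕ) (a : Fin n) → f a ≤ sum f
term≤sum f zero = m≤m+n _ _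
term≤sum f (suc a) = ≤-trans (term≤sum (λ i → f (suc i)) a) (m≤n+m _ _)

sum-pos⇒term-pos : ∀ {n} (f : Fin n → ℕ) → 0 < sum f → ∃ λ a → 0 < f a
sum-pos⇒term-pos {suc n} f 0<∑ with f zero in eq
... | suc _ = zero , subst (0 <_) (sym eq) (s≤s z≤n)
... | zero with sum-pos⇒term-pos (λ i → f (suc i)) 0<∑
...   | a , 0<fa = suc a , 0<fa

sum-indicator : ∀ {n} (a : Fin n) (f : Fin n → ℕ) → sum (λ i → ind (i == a) * f i) ≡ f a
sum-indicator {suc n} zero f = begin
    f zero + 0 + sum {n} (λ i → 0 * f (suc i))
  ≡⟨ cong (f zero + 0 +_) (sum-replicate-zero n) ⟩
    f zero + 0 + 0
  ≡⟨ trans (+-identityʳ _) (+-identityʳ _) ⟩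
    f zero
  ∎
  where open ≡-Reasoning
sum-indicator {suc n} (suc a) f =
  trans (sum-cong-≗ {n} (λ i → cong (λ b → ind b * f (suc i)) (==-suc i a)))
        (sum-indicator a (λ i → f (suc i)))

sum-indicator′ : ∀ {n} (a : Fin n) (f : Fin n → ℕ) → sum (λ i → ind (a == i) * f i) ≡ f a
sum-indicator′ a f = trans (sum-cong-≗ (λ i → cong (λ b → ind b * f i) (==-sym a i))) (sum-indicator a f)

sum₂ : ∀ {n} → (Fin n → Fin n → ℕ) → ℕ
sum₂ f = sum (λ x → sum (f x))

sum₂-mono-≤ : ∀ {n} {f g : Fin n → Fin n → ℕ} → (∀ x y → f x y ≤ g x y) → sum₂ f ≤ sum₂ g
sum₂-mono-≤ f≤g = sum-mono-≤ λ x → sum-mono-≤ (f≤g x)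

sum₂-cong : ∀ {n} {f g : Fin n → Fin n → ℕ} → (∀ x y → f x y ≡ g x y) → sum₂ f ≡ sum₂ g
sum₂-cong f≡g = sum-cong-≗ λ x → sum-cong-≗ (f≡g x)

sum₂-distrib-+ : ∀ {n} (f g : Fin n → Fin n → ℕ) → sum₂ (λ x y → f x y + g x y) ≡ sum₂ f + sum₂ g
sum₂-distrib-+ {n} f g = trans (sum-cong-≗ λ x → ∑-distrib-+ {n} (f x) (g x)) (∑-distrib-+ {n} (λ x → sum (f x)) (λ x → sum (g x)))

sum₂-zero : ∀ {n} → sum₂ {n} (λ _ _ → 0) ≡ 0
sum₂-zero {n} = trans (sum-cong-≗ {n} λ _ → sum-replicate-zero n) (sum-replicate-zero n)

pair-== : ∀ {n} {x y u v : Fin n} → (x == u) ∧ (y == v) ≡ true → (x ≡ u) × (y ≡ v)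
pair-== {x = x} {u = u} e with ∧-true {x == u} e
... | x=u , y=v = ==⇒≡ x=u , ==⇒≡ y=v

pair-==-disjoint : ∀ {n} {u v : Fin n} → u ≢ v → ∀ x y → ((x == u) ∧ (y == v)) ∧ ((x == v) ∧ (y == u)) ≡ false
pair-==-disjoint {u = u} {v} u≢v x y with (x == u) ∧ (y == v) in e | (x == v) ∧ (y == u) in e′
... | false | _ = refl
... | true | false = refl
... | true | true = ⊥-elim (u≢v (trans (sym (proj₁ (pair-== {y = y} e))) (proj₁ (pair-== {y = y} e′))))

sum-pair : ∀ {n} (w x z : Fin n) → sum (λ b → ind ((w == x) ∧ (b == z))) ≡ ind (w == x)
sum-pair {n} w x z = begin
    sum (λ b → ind ((w == x) ∧ (b == z)))
  ≡⟨ sum-cong-≗ {n} (λ b → trans (ind-∧ (w == x) (b == z)) (cong (ind (w == x) *_) (sym (*-identityʳ (ind (b == z)))))) ⟩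
    sum (λ b → ind (w == x) * (ind (b == z) * 1))
  ≡⟨ sym (*-distribˡ-sum (ind (w == x)) (λ b → ind (b == z) * 1)) ⟩
    ind (w == x) * sum (λ b → ind (b == z) * 1)
  ≡⟨ cong (ind (w == x) *_) (sum-indicator z (λ _ → 1)) ⟩
    ind (w == x) * 1
  ≡⟨ *-identityʳ _ ⟩
    ind (w == x)
  ∎
  where open ≡-Reasoning

sum₂-pair : ∀ {n} (x z : Fin n) → sum₂ (λ a b → ind ((a == x) ∧ (b == z))) ≡ 1
sum₂-pair {n} x z = trans (sum-cong-≗ {n} λ a → trans (sum-pair a x z) (sym (*-identityʳ (ind (a == x)))))
                          (sum-indicator x (λ _ → 1))

-- Orientations and the distance between them

Digraph : ℕ → Set
Digraph n = Fin n → Fin n → Bool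

-- the arcs (p , q) = (a x y , a y x) orient the edge status g of the pair {x , y}
Oriented : Bool → Bool → Bool → Set
Oriented true true _ = ⊥
Oriented true false g = g ≡ true
Oriented false true g = g ≡ true
Oriented false false g = g ≡ false

IsOrientation : ∀ {n} → Graph n → Digraph n → Set
IsOrientation G a = ∀ x y → Oriented (a x y) (a y x) (G x y)

outdeg : ∀ {n} → Digraph n → Fin n → ℕ
outdeg a x = sum (λ y → ind (a x y))

GoodOrientation : ∀ {n} → ℕ → Graph n → Digraph n → Set
GoodOrientation δ G O = IsOrientation G O × (∀ x → outdeg O x ≤ δ)

dist : ∀ {n} → Digraph n → Digraph n → ℕ
dist a O = sum₂ (λ x y → ind (a x y ∧ not (O x y)))

oriented-absent : ∀ p q g → Oriented p q g → g ≡ false → (p ≡ false) × (q ≡ false)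
oriented-absent false false g _ _ = refl , refl
oriented-absent true false .true refl ()
oriented-absent false true .true refl ()

oriented-antisym : ∀ p q g → Oriented p q g → p ≡ true → q ≡ false
oriented-antisym true false g _ _ = refl

isOrientation-sym : ∀ {n} {G : Graph n} {a : Digraph n} → IsOrientation G a → ∀ x y → G x y ≡ G y x
isOrientation-sym {G = G} {a} o x y with a x y | a y x | o x y | o y x
... | true | false | gxy | gyx = trans gxy (sym gyx)
... | false | true | gxy | gyx = trans gxy (sym gyx)
... | false | false | gxy | gyx = trans gxy (sym gyx)

isOrientation-irrefl : ∀ {n} {G : Graph n} {a : Digraph n} → IsOrientation G a → ∀ x → G x x ≡ false
isOrientation-irrefl {a = a} o x with a x x | o x x
... | false | gxx = gxx

isOrientation-cong : ∀ {n} {G G′ : Graph n} {a b : Digraph n} → (∀ x y → a x y ≡ b x y) → (∀ x y → G x y ≡ G′ x y) →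
                     IsOrientation G a → IsOrientation G′ b
isOrientation-cong a≡b G≡G′ o x y rewrite sym (a≡b x y) | sym (a≡b y x) | sym (G≡G′ x y) = o x y

isEdge-sym : ∀ {n} (u v x y : Fin n) → isEdge u v x y ≡ isEdge u v y x
isEdge-sym u v x y rewrite ∧-comm (x == u) (y == v) | ∧-comm (x == v) (y == u) = ∨-comm (y == v ∧ x == u) (y == u ∧ x == v)

withEdge : ∀ {n} → Fin n → Fin n → Graph n → Graph n
withEdge u v G x y = isEdge u v x y ∨ G x y

withoutEdge : ∀ {n} → Fin n → Fin n → Graph n → Graph n
withoutEdge u v G x y = not (isEdge u v x y) ∧ G x y

addArc : ∀ {n} → Digraph n → Fin n → Fin n → Digraph n
addArc a u v x y = a x y ∨ ((x == u) ∧ (y == v))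

dropEdge : ∀ {n} → Digraph n → Fin n → Fin n → Digraph n
dropEdge a u v x y = a x y ∧ not (isEdge u v x y)

reverseAt : ∀ {n} → Digraph n → Fin n → Digraph n
reverseAt a u x y = if x == u then false else (a x y ∨ ((y == u) ∧ a u x))

flipArc : ∀ {n} → Digraph n → Fin n → Fin n → Digraph n
flipArc a x z p q = (a p q ∧ not ((p == x) ∧ (q == z))) ∨ ((p == z) ∧ (q == x))

isOrientation-addArc : ∀ {n} {G : Graph n} {a : Digraph n} {u v : Fin n} → IsOrientation G a → G u v ≡ false → u ≢ v →
                       IsOrientation (withEdge u v G) (addArc a u v)
isOrientation-addArc {G = G} {a} {u} {v} o guv u≢v x y rewrite ∧-comm (y == u) (x == v) =
  add (a x y) (a y x) (G x y) ((x == u) ∧ (y == v)) ((x == v) ∧ (y == u)) (o x y) at-uv at-vu (pair-==-disjoint u≢v x y)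
  where
  Absent : Bool → Bool → Bool → Set
  Absent p q g = (p ≡ false) × (q ≡ false) × (g ≡ false)
  add : ∀ p q g e₁ e₂ → Oriented p q g → (e₁ ≡ true → Absent p q g) → (e₂ ≡ true → Absent p q g) →
        e₁ ∧ e₂ ≡ false → Oriented (p ∨ e₁) (q ∨ e₂) ((e₁ ∨ e₂) ∨ g)
  add p q g true false _ h₁ _ _ with h₁ refl
  ... | refl , refl , refl = refl
  add p q g false true _ _ h₂ _ with h₂ refl
  ... | refl , refl , refl = refl
  add p q g false false o _ _ _ rewrite ∨-identityʳ p | ∨-identityʳ q = o
  absent-uv : Absent (a u v) (a v u) (G u v)
  absent-uv = let (p , q) = oriented-absent (a u v) (a v u) (G u v) (o u v) guv in p , q , guv
  at-uv : (x == u) ∧ (y == v) ≡ true → Absent (a x y) (a y x) (G x y)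
  at-uv e with pair-== {x = x} e
  ... | refl , refl = absent-uv
  at-vu : (x == v) ∧ (y == u) ≡ true → Absent (a x y) (a y x) (G x y)
  at-vu e with pair-== {x = x} e
  ... | refl , refl = proj₁ (proj₂ absent-uv) , proj₁ absent-uv , trans (isOrientation-sym o v u) guv

isOrientation-dropEdge : ∀ {n} {G : Graph n} {a : Digraph n} (u v : Fin n) → IsOrientation G a →
                         IsOrientation (withoutEdge u v G) (dropEdge a u v)
isOrientation-dropEdge {G = G} {a} u v o x y rewrite isEdge-sym u v y x = drop (a x y) (a y x) (G x y) (isEdge u v x y) (o x y)
  where
  drop : ∀ p q g e → Oriented p q g → Oriented (p ∧ not e) (q ∧ not e) (not e ∧ g)
  drop true false g true _ = refl
  drop false true g true _ = refl
  drop false false g true _ = refl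
  drop true false g false o = o
  drop false true g false o = o
  drop false false g false o = o

isOrientation-reverseAt : ∀ {n} {G : Graph n} {a : Digraph n} (u : Fin n) → IsOrientation G a → IsOrientation G (reverseAt a u)
isOrientation-reverseAt {G = G} {a} u o x y with x ≟ u | y ≟ u
... | yes refl | yes refl = isOrientation-irrefl o u
... | yes refl | no y≢u = swap-into-q (a x y) (a y x) (G x y) (o x y)
  where
  swap-into-q : ∀ p q g → Oriented p q g → Oriented false (q ∨ p) g
  swap-into-q true false g o = o
  swap-into-q false true g o = o
  swap-into-q false false g o = o
... | no x≢u | yes refl = swap-into-p (a x y) (a y x) (G x y) (o x y)
  where
  swap-into-p : ∀ p q g → Oriented p q g → Oriented (p ∨ q) false g
  swap-into-p true false g o = o
  swap-into-p false true g o = o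
  swap-into-p false false g o = o
... | no x≢u | no y≢u rewrite ∨-identityʳ (a x y) | ∨-identityʳ (a y x) = o x y

arc⇒≢ : ∀ {n} {G : Graph n} {a : Digraph n} {x z : Fin n} → IsOrientation G a → a x z ≡ true → x ≢ z
arc⇒≢ {a = a} {x} o axz refl with a x x | o x x
arc⇒≢ o axz refl | true | ()

isOrientation-flipArc : ∀ {n} {G : Graph n} {a : Digraph n} {x z : Fin n} → IsOrientation G a → a x z ≡ true →
                        IsOrientation G (flipArc a x z)
isOrientation-flipArc {G = G} {a} {x} {z} o axz p q rewrite ∧-comm (q == x) (p == z) | ∧-comm (q == z) (p == x) =
  flip (a p q) (a q p) (G p q) ((p == x) ∧ (q == z)) ((p == z) ∧ (q == x)) (o p q) at-xz at-zx (pair-==-disjoint (arc⇒≢ o axz) p q)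
  where
  flip : ∀ r s g e₁ e₂ → Oriented r s g → (e₁ ≡ true → (r ≡ true) × (s ≡ false)) →
         (e₂ ≡ true → (s ≡ true) × (r ≡ false)) → e₁ ∧ e₂ ≡ false →
         Oriented ((r ∧ not e₁) ∨ e₂) ((s ∧ not e₂) ∨ e₁) g
  flip r s g true false o h₁ _ _ with h₁ refl
  ... | refl , refl = o
  flip r s g false true o _ h₂ _ with h₂ refl
  ... | refl , refl = o
  flip true false g false false o _ _ _ = o
  flip false true g false false o _ _ _ = o
  flip false false g false false o _ _ _ = o
  at-xz : (p == x) ∧ (q == z) ≡ true → (a p q ≡ true) × (a q p ≡ false)
  at-xz e with pair-== {x = p} e
  ... | refl , refl = axz , oriented-antisym (a p q) (a q p) (G p q) (o p q) axz
  at-zx : (p == z) ∧ (q == x) ≡ true → (a q p ≡ true) × (a p q ≡ false)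
  at-zx e with pair-== {x = p} e
  ... | refl , refl = axz , oriented-antisym (a q p) (a p q) (G q p) (o q p) axz

dist-cong : ∀ {n} {a b : Digraph n} (O : Digraph n) → (∀ x y → a x y ≡ b x y) → dist a O ≡ dist b O
dist-cong O a≡b = sum₂-cong λ x y → cong (λ z → ind (z ∧ not (O x y))) (a≡b x y)

dist-self : ∀ {n} (a : Digraph n) → dist a a ≡ 0
dist-self {n} a = trans (sum₂-cong λ x y → no-self (a x y)) (sum₂-zero {n})
  where
  no-self : ∀ p → ind (p ∧ not p) ≡ 0
  no-self true = refl
  no-self false = refl

dist-triangle : ∀ {n} (a b c : Digraph n) → dist a c ≤ dist a b + dist b c
dist-triangle a b c = ≤-trans (sum₂-mono-≤ λ x y → split (a x y) (c x y) (b x y))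
                              (≤-reflexive (sum₂-distrib-+ (λ x y → ind (a x y ∧ not (b x y))) (λ x y → ind (b x y ∧ not (c x y)))))
  where
  split : ∀ p r q → ind (p ∧ not r) ≤ ind (p ∧ not q) + ind (q ∧ not r)
  split true false true = ≤-refl
  split true false false = ≤-refl
  split true true q = z≤n
  split false r q = z≤n

dist-monoˡ : ∀ {n} {a b : Digraph n} (O : Digraph n) → (∀ x y → a x y ≡ true → b x y ≡ true) → dist a O ≤ dist b O
dist-monoˡ {a = a} {b} O a⊆b = sum₂-mono-≤ λ x y → mono (a x y) (b x y) (O x y) (a⊆b x y)
  where
  mono : ∀ p q o → (p ≡ true → q ≡ true) → ind (p ∧ not o) ≤ ind (q ∧ not o)
  mono true q o p⇒q rewrite p⇒q refl = ≤-refl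
  mono false q o _ = z≤n

dist-antitoneʳ : ∀ {n} (a : Digraph n) {O O′ : Digraph n} → (∀ x y → O x y ≡ true → O′ x y ≡ true) → dist a O′ ≤ dist a O
dist-antitoneʳ a {O} {O′} O⊆O′ = sum₂-mono-≤ λ x y → antitone (a x y) (O x y) (O′ x y) (O⊆O′ x y)
  where
  antitone : ∀ p o o′ → (o ≡ true → o′ ≡ true) → ind (p ∧ not o′) ≤ ind (p ∧ not o)
  antitone p true o′ o⇒o′ rewrite o⇒o′ refl = ≤-refl
  antitone true false o′ _ = ind≤1 (not o′)
  antitone false false o′ _ = z≤n

dist-addArc : ∀ {n} (a O : Digraph n) (u v : Fin n) → dist (addArc a u v) O ≤ dist a O + 1
dist-addArc a O u v = begin
    dist (addArc a u v) O
  ≤⟨ sum₂-mono-≤ (λ x y → split (a x y) ((x == u) ∧ (y == v)) (O x y)) ⟩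
    sum₂ (λ x y → ind (a x y ∧ not (O x y)) + ind ((x == u) ∧ (y == v)))
  ≡⟨ sum₂-distrib-+ (λ x y → ind (a x y ∧ not (O x y))) (λ x y → ind ((x == u) ∧ (y == v))) ⟩
    dist a O + sum₂ (λ x y → ind ((x == u) ∧ (y == v)))
  ≡⟨ cong (dist a O +_) (sum₂-pair u v) ⟩
    dist a O + 1
  ∎
  where
  open ≤-Reasoning
  split : ∀ p e o → ind ((p ∨ e) ∧ not o) ≤ ind (p ∧ not o) + ind e
  split true e true = z≤n
  split true e false = m≤m+n 1 (ind e)
  split false true o = ind≤1 (not o)
  split false false o = z≤n

outdeg-addArc : ∀ {n} (a : Digraph n) (u v w : Fin n) → outdeg (addArc a u v) w ≤ outdeg a w + ind (w == u)
outdeg-addArc a u v w = begin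
    outdeg (addArc a u v) w
  ≤⟨ sum-mono-≤ (λ b → split (a w b) ((w == u) ∧ (b == v))) ⟩
    sum (λ b → ind (a w b) + ind ((w == u) ∧ (b == v)))
  ≡⟨ ∑-distrib-+ (λ b → ind (a w b)) (λ b → ind ((w == u) ∧ (b == v))) ⟩
    outdeg a w + sum (λ b → ind ((w == u) ∧ (b == v)))
  ≡⟨ cong (outdeg a w +_) (sum-pair w u v) ⟩
    outdeg a w + ind (w == u)
  ∎
  where
  open ≤-Reasoning
  split : ∀ p e → ind (p ∨ e) ≤ ind p + ind e
  split true e = m≤m+n 1 (ind e)
  split false e = ≤-refl

outdeg-dropEdge : ∀ {n} (a : Digraph n) (u v w : Fin n) → outdeg (dropEdge a u v) w ≤ outdeg a w
outdeg-dropEdge a u v w = sum-mono-≤ λ b → drop (a w b) (not (isEdge u v w b))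
  where
  drop : ∀ p e → ind (p ∧ e) ≤ ind p
  drop true e = ind≤1 e
  drop false e = z≤n

agreeOut : ∀ {n} → Digraph n → Digraph n → Fin n → ℕ
agreeOut a O u = sum (λ y → ind (a u y ∧ O u y))

disagreeOut : ∀ {n} → Digraph n → Digraph n → Fin n → ℕ
disagreeOut a O u = sum (λ y → ind (a u y ∧ not (O u y)))

agreeOut+disagreeOut : ∀ {n} (a O : Digraph n) u → agreeOut a O u + disagreeOut a O u ≡ outdeg a u
agreeOut+disagreeOut a O u = trans (sym (∑-distrib-+ (λ y → ind (a u y ∧ O u y)) (λ y → ind (a u y ∧ not (O u y)))))
                                   (sum-cong-≗ λ y → split (a u y) (O u y))
  where
  split : ∀ p o → ind (p ∧ o) + ind (p ∧ not o) ≡ ind p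
  split true true = refl
  split true false = refl
  split false o = refl

agreeOut≤outdeg : ∀ {n} (a O : Digraph n) u → agreeOut a O u ≤ outdeg O u
agreeOut≤outdeg a O u = sum-mono-≤ λ y → both (a u y) (O u y)
  where
  both : ∀ p o → ind (p ∧ o) ≤ ind o
  both true o = ≤-refl
  both false o = z≤n

-- Reversing the out-arcs of u turns its disagreeing arcs into agreeing ones and vice versa.
dist-reverseAt : ∀ {n} {G : Graph n} (a O : Digraph n) (u : Fin n) → IsOrientation G a → IsOrientation G O →
                 dist (reverseAt a u) O + disagreeOut a O u ≤ dist a O + agreeOut a O u
dist-reverseAt {n} {G} a O u oa oO = begin
    dist (reverseAt a u) O + disagreeOut a O u
  ≡⟨ cong (dist (reverseAt a u) O +_) (sym (sum-indicator′ u (λ _ → disagreeOut a O u))) ⟩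
    dist (reverseAt a u) O + sum (λ x → ind (u == x) * disagreeOut a O u)
  ≡⟨ cong (dist (reverseAt a u) O +_) (sum-cong-≗ {n} λ x → *-distribˡ-sum (ind (u == x)) (λ y → ind (a u y ∧ not (O u y)))) ⟩
    dist (reverseAt a u) O + sum₂ (λ x y → ind (u == x) * ind (a u y ∧ not (O u y)))
  ≡⟨ sym (sum₂-distrib-+ (λ x y → ind (reverseAt a u x y ∧ not (O x y))) (λ x y → ind (u == x) * ind (a u y ∧ not (O u y)))) ⟩
    sum₂ (λ x y → ind (reverseAt a u x y ∧ not (O x y)) + ind (u == x) * ind (a u y ∧ not (O u y)))
  ≤⟨ sum₂-mono-≤ pointwise ⟩
    sum₂ (λ x y → ind (a x y ∧ not (O x y)) + ind (y == u) * ind (a u x ∧ O u x))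
  ≡⟨ sum₂-distrib-+ (λ x y → ind (a x y ∧ not (O x y))) (λ x y → ind (y == u) * ind (a u x ∧ O u x)) ⟩
    dist a O + sum₂ (λ x y → ind (y == u) * ind (a u x ∧ O u x))
  ≡⟨ cong (dist a O +_) (sum-cong-≗ {n} λ x → sum-indicator u (λ _ → ind (a u x ∧ O u x))) ⟩
    dist a O + agreeOut a O u
  ∎
  where
  open ≤-Reasoning
  reversed : ∀ p q o o′ g → Oriented p q g → Oriented o o′ g →
             ind ((q ∨ p) ∧ not o′) ≤ ind (q ∧ not o′) + ind (p ∧ o)
  reversed true false true o′ g _ _ = ind≤1 (not o′)
  reversed true false false true g _ _ = z≤n
  reversed true false false false g refl ()
  reversed false q o o′ g _ _ rewrite ∨-identityʳ q = m≤m+n _ _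
  pointwise : ∀ x y → ind (reverseAt a u x y ∧ not (O x y)) + ind (u == x) * ind (a u y ∧ not (O u y))
                    ≤ ind (a x y ∧ not (O x y)) + ind (y == u) * ind (a u x ∧ O u x)
  pointwise x y with x ≟ u
  ... | yes refl rewrite ==-refl x | +-identityʳ (ind (a x y ∧ not (O x y))) = m≤m+n _ _
  ... | no x≢u rewrite ≢⇒==false (λ e → x≢u (sym e)) | +-identityʳ (ind ((a x y ∨ ((y == u) ∧ a u x)) ∧ not (O x y))) with y ≟ u
  ...   | no _ rewrite ∨-identityʳ (a x y) = m≤m+n _ _
  ...   | yes refl rewrite +-identityʳ (ind (a y x ∧ O y x)) = reversed (a y x) (a x y) (O y x) (O x y) (G y x) (oa y x) (oO y x)

outdeg-flipArc : ∀ {n} (a : Digraph n) {x z : Fin n} → a x z ≡ true → x ≢ z →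
                 ∀ w → outdeg (flipArc a x z) w + ind (w == x) ≤ outdeg a w + ind (w == z)
outdeg-flipArc a {x} {z} axz x≢z w = begin
    outdeg (flipArc a x z) w + ind (w == x)
  ≡⟨ cong (outdeg (flipArc a x z) w +_) (sym (sum-pair w x z)) ⟩
    outdeg (flipArc a x z) w + sum (λ b → ind ((w == x) ∧ (b == z)))
  ≡⟨ sym (∑-distrib-+ (λ b → ind (flipArc a x z w b)) (λ b → ind ((w == x) ∧ (b == z)))) ⟩
    sum (λ b → ind (flipArc a x z w b) + ind ((w == x) ∧ (b == z)))
  ≤⟨ sum-mono-≤ (λ b → flip (a w b) ((w == x) ∧ (b == z)) ((w == z) ∧ (b == x)) (at-xz b) (pair-==-disjoint x≢z w b)) ⟩
    sum (λ b → ind (a w b) + ind ((w == z) ∧ (b == x)))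
  ≡⟨ ∑-distrib-+ (λ b → ind (a w b)) (λ b → ind ((w == z) ∧ (b == x))) ⟩
    outdeg a w + sum (λ b → ind ((w == z) ∧ (b == x)))
  ≡⟨ cong (outdeg a w +_) (sum-pair w z x) ⟩
    outdeg a w + ind (w == z)
  ∎
  where
  open ≤-Reasoning
  flip : ∀ p e₁ e₂ → (e₁ ≡ true → p ≡ true) → e₁ ∧ e₂ ≡ false →
         ind ((p ∧ not e₁) ∨ e₂) + ind e₁ ≤ ind p + ind e₂
  flip p true false e₁⇒p _ rewrite e₁⇒p refl = ≤-refl
  flip true false true _ _ = m≤n+m 1 1
  flip false false true _ _ = ≤-refl
  flip true false false _ _ = ≤-refl
  flip false false false _ _ = ≤-refl
  at-xz : ∀ b → (w == x) ∧ (b == z) ≡ true → a w b ≡ true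
  at-xz b e with pair-== {x = w} e
  ... | refl , refl = axz

dist-flipArc : ∀ {n} (a : Digraph n) (x z : Fin n) → dist (flipArc a x z) a ≤ 1
dist-flipArc a x z = ≤-trans (sum₂-mono-≤ (λ p q → flipped (a p q) ((p == x) ∧ (q == z)) ((p == z) ∧ (q == x))))
                             (≤-reflexive (sum₂-pair z x))
  where
  flipped : ∀ p e₁ e₂ → ind (((p ∧ not e₁) ∨ e₂) ∧ not p) ≤ ind e₂
  flipped true true true = z≤n
  flipped true true false = z≤n
  flipped true false e₂ = z≤n
  flipped false e₁ true = ≤-refl
  flipped false e₁ false = z≤n

Distinct : ∀ {n} → List (Fin n) → Set
Distinct [] = ⊤
Distinct (a ∷ l) = (mem a l ≡ false) × Distinct l

arcs : ∀ {n} → Out n → Digraph n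
arcs s x y = mem y (s x)

Represents : ∀ {n} → Graph n → Out n → Set
Represents G s = IsOrientation G (arcs s) × (∀ w → Distinct (s w))

count-mem : ∀ {n} (l : List (Fin n)) → Distinct l → sum (λ y → ind (mem y l)) ≡ length l
count-mem {n} [] _ = sum-replicate-zero n
count-mem {n} (a ∷ l) (a∉l , distinct) = begin
    sum (λ y → ind ((y == a) ∨ mem y l))
  ≡⟨ sum-cong-≗ {n} (λ y → split (y == a) (mem y l) (λ e → trans (cong (λ z → mem z l) (==⇒≡ e)) a∉l)) ⟩
    sum (λ y → ind (y == a) * 1 + ind (mem y l))
  ≡⟨ ∑-distrib-+ (λ y → ind (y == a) * 1) (λ y → ind (mem y l)) ⟩
    sum (λ y → ind (y == a) * 1) + sum (λ y → ind (mem y l))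
  ≡⟨ cong₂ _+_ (sum-indicator a (λ _ → 1)) (count-mem l distinct) ⟩
    suc (length l)
  ∎
  where
  open ≡-Reasoning
  split : ∀ e m → (e ≡ true → m ≡ false) → ind (e ∨ m) ≡ ind e * 1 + ind m
  split true m e⇒¬m rewrite e⇒¬m refl = refl
  split false m _ = refl

outdeg-arcs : ∀ {n} {G : Graph n} {s : Out n} → Represents G s → ∀ w → outdeg (arcs s) w ≡ length (s w)
outdeg-arcs {s = s} (_ , distinct) w = count-mem (s w) (distinct w)

mem-filter : ∀ {n} (v w : Fin n) (l : List (Fin n)) → mem w (filterᵇ (λ y → not (y == v)) l) ≡ mem w l ∧ not (w == v)
mem-filter v w [] = refl
mem-filter v w (a ∷ l) with a ≟ v
... | yes refl = drop-head (w == a) (mem w l) (mem-filter a w l)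
  where
  drop-head : ∀ e m → mem w (filterᵇ (λ y → not (y == a)) l) ≡ m ∧ not e →
              mem w (filterᵇ (λ y → not (y == a)) l) ≡ (e ∨ m) ∧ not e
  drop-head true m h = trans h (∧-comm m false)
  drop-head false m h = h
... | no a≢v with w ≟ a
...   | yes refl rewrite ≢⇒==false a≢v = refl
...   | no _ = mem-filter v w l

distinct-filter : ∀ {n} (v : Fin n) (l : List (Fin n)) → Distinct l → Distinct (filterᵇ (λ y → not (y == v)) l)
distinct-filter v [] _ = tt
distinct-filter v (a ∷ l) (a∉l , distinct) with a ≟ v
... | yes refl = distinct-filter a l distinct
... | no _ = trans (mem-filter v a l) (cong (_∧ not (a == v)) a∉l) , distinct-filter v l distinct

length-filter : ∀ {n} (v : Fin n) (l : List (Fin n)) → length (filterᵇ (λ y → not (y == v)) l) ≤ length l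
length-filter v [] = z≤n
length-filter v (a ∷ l) with a ≟ v
... | yes refl = m≤n⇒m≤1+n (length-filter a l)
... | no _ = s≤s (length-filter v l)

arcs-addOut : ∀ {n} (s : Out n) (u v x y : Fin n) → arcs (addOut s u v) x y ≡ addArc (arcs s) u v x y
arcs-addOut s u v x y with x ≟ u
... | yes refl = ∨-comm (y == v) (mem y (s x))
... | no _ = sym (∨-identityʳ (mem y (s x)))

arcs-reverseAll : ∀ {n} (s : Out n) (u x y : Fin n) → arcs (reverseAll s u) x y ≡ reverseAt (arcs s) u x y
arcs-reverseAll s u x y with x ≟ u
... | yes refl = refl
... | no _ with mem x (s u)
...   | true rewrite ∧-identityʳ (y == u) = ∨-comm (y == u) (mem y (s x))
...   | false rewrite ∧-comm (y == u) false = sym (∨-identityʳ (mem y (s x)))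

arcs-deleteEdge : ∀ {n} (s : Out n) (u v x y : Fin n) → u ≢ v → arcs (deleteEdge s u v) x y ≡ dropEdge (arcs s) u v x y
arcs-deleteEdge s u v x y u≢v with x ≟ v
arcs-deleteEdge s u v x y u≢v | yes refl with x ≟ u
... | yes refl = ⊥-elim (u≢v refl)
... | no _ rewrite mem-filter u y (s x) = refl
arcs-deleteEdge s u v x y u≢v | no _ with x ≟ u
... | yes refl rewrite mem-filter v y (s x) | ∨-identityʳ (y == v) = refl
... | no _ rewrite ∧-identityʳ (mem y (s x)) = refl

represents-addOut : ∀ {n} {G : Graph n} (s : Out n) (u v : Fin n) → Represents G s → G u v ≡ false → u ≢ v →
                    Represents (withEdge u v G) (addOut s u v)
represents-addOut {G = G} s u v (o , distinct) guv u≢v =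
  isOrientation-cong (λ x y → sym (arcs-addOut s u v x y)) (λ _ _ → refl) (isOrientation-addArc o guv u≢v) ,
  distinct′
  where
  distinct′ : ∀ w → Distinct (addOut s u v w)
  distinct′ w with w ≟ u
  ... | yes refl = proj₁ (oriented-absent (mem v (s u)) (mem u (s v)) (G u v) (o u v) guv) , distinct w
  ... | no _ = distinct w

represents-reverseAll : ∀ {n} {G : Graph n} (s : Out n) (u : Fin n) → Represents G s → Represents G (reverseAll s u)
represents-reverseAll {G = G} s u (o , distinct) =
  isOrientation-cong (λ x y → sym (arcs-reverseAll s u x y)) (λ _ _ → refl) (isOrientation-reverseAt u o) ,
  distinct′
  where
  distinct′ : ∀ w → Distinct (reverseAll s u w)
  distinct′ w with w ≟ u
  ... | yes _ = tt
  ... | no _ with mem w (s u) in u→w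
  ...   | true = oriented-antisym (mem w (s u)) (mem u (s w)) (G u w) (o u w) u→w , distinct w
  ...   | false = distinct w

distinct-removeArc : ∀ {n} (s : Out n) (u v : Fin n) → (∀ w → Distinct (s w)) → ∀ w → Distinct (removeArc s u v w)
distinct-removeArc s u v distinct w with w ≟ u
... | yes _ = distinct-filter v (s w) (distinct w)
... | no _ = distinct w

represents-deleteEdge : ∀ {n} {G : Graph n} (s : Out n) (u v : Fin n) → Represents G s → u ≢ v →
                        Represents (withoutEdge u v G) (deleteEdge s u v)
represents-deleteEdge s u v (o , distinct) u≢v =
  isOrientation-cong (λ x y → sym (arcs-deleteEdge s u v x y u≢v)) (λ _ _ → refl) (isOrientation-dropEdge u v o) ,
  distinct-removeArc (removeArc s u v) v u (distinct-removeArc s u v distinct)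

length-removeArc : ∀ {n} (s : Out n) (u v w : Fin n) → length (removeArc s u v w) ≤ length (s w)
length-removeArc s u v w with w ≟ u
... | yes _ = length-filter v (s w)
... | no _ = ≤-refl

length-deleteEdge : ∀ {n} (s : Out n) (u v w : Fin n) → length (deleteEdge s u v w) ≤ length (s w)
length-deleteEdge s u v w = ≤-trans (length-removeArc (removeArc s u v) v u w) (length-removeArc s u v w)

-- Cycles from walks

InjectiveUpTo : ∀ {n} → (ℕ → Fin n) → ℕ → Set
InjectiveUpTo f N = ∀ i j → i < j → j ≤ N → f i ≢ f j

FirstRepeat : ∀ {n} → (ℕ → Fin n) → Set
FirstRepeat f = Σ ℕ λ j → Σ ℕ λ i → i < suc j × f i ≡ f (suc j) × InjectiveUpTo f j

occursBefore? : ∀ {n} (f : ℕ → Fin n) (m k : ℕ) → (Σ ℕ λ i → i < k × f i ≡ f m) ⊎ (∀ i → i < k → f i ≢ f m)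
occursBefore? f m zero = inj₂ (λ i ())
occursBefore? f m (suc k) with occursBefore? f m k
... | inj₁ (i , i<k , fi≡fm) = inj₁ (i , m<n⇒m<1+n i<k , fi≡fm)
... | inj₂ ¬earlier with f k ≟ f m
...   | yes fk≡fm = inj₁ (k , n<1+n k , fk≡fm)
...   | no fk≢fm = inj₂ λ i i<1+k → [ ¬earlier i , (λ { refl → fk≢fm }) ]′ (m<1+n⇒m<n∨m≡n i<1+k)

firstRepeat? : ∀ {n} (f : ℕ → Fin n) (N : ℕ) → FirstRepeat f ⊎ InjectiveUpTo f N
firstRepeat? f zero = inj₂ (λ { i zero () z≤n ; i (suc j) _ () })
firstRepeat? f (suc N) with firstRepeat? f N
... | inj₁ r = inj₁ r
... | inj₂ inj with occursBefore? f (suc N) (suc N)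
...   | inj₁ (i , i<1+N , fi≡f1+N) = inj₁ (N , i , i<1+N , fi≡f1+N , inj)
...   | inj₂ new = inj₂ λ i j i<j j≤1+N →
          [ (λ j<1+N → inj i j i<j (≤-pred j<1+N)) , (λ { refl → new i i<j }) ]′ (m≤n⇒m<n∨m≡n j≤1+N)

segment-injective : ∀ {n} {f : ℕ → Fin n} {N : ℕ} (i m : ℕ) → i + m ≤ N → InjectiveUpTo f N →
                    Injective _≡_ _≡_ (λ (t : Fin (suc m)) → f (i + toℕ t))
segment-injective {f = f} {N} i m i+m≤N inj {t} {t′} ft≡ft′ = case (<-cmp (toℕ t) (toℕ t′))
  where
  inside : ∀ (t : Fin (suc m)) → i + toℕ t ≤ N
  inside t = ≤-trans (+-monoʳ-≤ i (≤-pred (toℕ<n t))) i+m≤N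
  case : Tri (toℕ t < toℕ t′) (toℕ t ≡ toℕ t′) (toℕ t′ < toℕ t) → t ≡ t′
  case (tri< t<t′ _ _) = ⊥-elim (inj _ _ (+-monoʳ-< i t<t′) (inside t′) ft≡ft′)
  case (tri≈ _ t≡t′ _) = toℕ-injective t≡t′
  case (tri> _ _ t>t′) = ⊥-elim (inj _ _ (+-monoʳ-< i t>t′) (inside t) (sym ft≡ft′))

firstRepeat : ∀ {n} (f : ℕ → Fin n) → FirstRepeat f
firstRepeat {n} f with firstRepeat? f n
... | inj₁ r = r
... | inj₂ inj = ⊥-elim (1+n≰n (injective⇒≤ (segment-injective {f = f} 0 n ≤-refl inj)))

-- The cycle is the stretch f i … f j before the first repeated vertex f (suc j) = f i.
walk⇒cycle : ∀ {n} (H : Fin n → Fin n → Bool) (f : ℕ → Fin n) →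
             (∀ m → H (f m) (f (suc m)) ≡ true) → (∀ m → f (suc (suc m)) ≢ f m) → (∀ x → H x x ≡ false) →
             Cycle (λ x y → H x y ≡ true)
walk⇒cycle {n} H f edge nonBacktracking irrefl with firstRepeat f
... | j , i , i<1+j , fi≡f1+j , inj with m<1+n⇒m<n∨m≡n i<1+j
...   | inj₂ refl = ⊥-elim (true≢false (trans (cong (H (f j)) fi≡f1+j) (edge j)) (irrefl (f j)))
...   | inj₁ i<j with m≤n⇒m<n∨m≡n i<j
...     | inj₂ refl = ⊥-elim (nonBacktracking i (sym fi≡f1+j))
...     | inj₁ 1+i<j with m≤n⇒∃[o]m+o≡n 1+i<j
...       | k , 2+i+k≡j = record { k = k ; vs = vs ; inj = segment-injective i (suc (suc k)) (≤-reflexive i+2+k≡j) inj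
                                  ; adj = adj ; close = close }
  where
  i+2+k≡j : i + suc (suc k) ≡ j
  i+2+k≡j = trans (+-suc i (suc k)) (trans (cong suc (+-suc i k)) 2+i+k≡j)
  vs : Fin (suc (suc (suc k))) → Fin n
  vs t = f (i + toℕ t)
  adj : (t : Fin (suc (suc k))) → H (vs (inject₁ t)) (vs (suc t)) ≡ true
  adj t rewrite toℕ-inject₁ t | +-suc i (toℕ t) = edge (i + toℕ t)
  close : H (vs (fromℕ (suc (suc k)))) (vs zero) ≡ true
  close rewrite toℕ-fromℕ (suc (suc k)) | +-identityʳ i | i+2+k≡j | fi≡f1+j = edge j

-- Forests and sparse graphs

Subset : ℕ → Set
Subset n = Fin n → Bool

card : ∀ {n} → Subset n → ℕ
card T = sum (λ y → ind (T y))

-- ordered pairs of adjacent vertices of T: twice the number of edges inside T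
pairsIn : ∀ {n} → Graph n → Subset n → ℕ
pairsIn H T = sum₂ (λ x y → ind (T x ∧ T y ∧ H x y))

degIn : ∀ {n} → Graph n → Subset n → Fin n → ℕ
degIn H T w = sum (λ y → ind (T y ∧ H w y))

remove : ∀ {n} → Subset n → Fin n → Subset n
remove T w y = T y ∧ not (y == w)

card≤n : ∀ {n} (T : Subset n) → card T ≤ n
card≤n {n} T = ≤-trans (sum-mono-≤ (λ y → ind≤1 (T y))) (≤-reflexive (trans (sum-const {n} 1) (*-identityʳ n)))

card-remove : ∀ {n} (T : Subset n) (w : Fin n) → T w ≡ true → card T ≡ suc (card (remove T w))
card-remove {n} T w w∈T = begin
    card T
  ≡⟨ sum-cong-≗ {n} split ⟩
    sum (λ y → ind (remove T w y) + ind (y == w) * 1)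
  ≡⟨ ∑-distrib-+ (λ y → ind (remove T w y)) (λ y → ind (y == w) * 1) ⟩
    card (remove T w) + sum (λ y → ind (y == w) * 1)
  ≡⟨ cong (card (remove T w) +_) (sum-indicator w (λ _ → 1)) ⟩
    card (remove T w) + 1
  ≡⟨ +-comm (card (remove T w)) 1 ⟩
    suc (card (remove T w))
  ∎
  where
  open ≡-Reasoning
  split : ∀ y → ind (T y) ≡ ind (T y ∧ not (y == w)) + ind (y == w) * 1
  split y with y ≟ w
  ... | yes refl rewrite w∈T = refl
  ... | no _ rewrite ∧-identityʳ (T y) = sym (+-identityʳ _)

card-pos⇒member : ∀ {n} (T : Subset n) → 0 < card T → ∃ λ w → T w ≡ true
card-pos⇒member T 0<|T| with sum-pos⇒term-pos (λ y → ind (T y)) 0<|T|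
... | w , 0<ind with T w in w∈T
... | true = w , w∈T

card-zero⇒empty : ∀ {n} (T : Subset n) → card T ≡ 0 → ∀ y → T y ≡ false
card-zero⇒empty T |T|≡0 y with T y in y∈T
... | false = refl
... | true = ⊥-elim (1+n≰n (≤-trans (subst (λ b → 1 ≤ ind b) (sym y∈T) ≤-refl)
                                     (≤-trans (term≤sum (λ y → ind (T y)) y) (≤-reflexive |T|≡0))))

pairsIn-empty : ∀ {n} (H : Graph n) (T : Subset n) → card T ≡ 0 → pairsIn H T ≡ 0
pairsIn-empty {n} H T |T|≡0 = trans (sum₂-cong λ x y → cong (λ b → ind (b ∧ T y ∧ H x y)) (card-zero⇒empty T |T|≡0 x))
                                    (sum₂-zero {n})

module _ {n : ℕ} (H : Graph n) (H-sym : ∀ x y → H x y ≡ H y x) (H-irrefl : ∀ x → H x x ≡ false) where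

  pairsIn-remove : ∀ (T : Subset n) (w : Fin n) → T w ≡ true →
                   pairsIn H T ≡ pairsIn H (remove T w) + (degIn H T w + degIn H T w)
  pairsIn-remove T w w∈T = begin
      pairsIn H T
    ≡⟨ sum₂-cong split ⟩
      sum₂ (λ x y → ind (T′ x ∧ T′ y ∧ H x y) + (ind (x == w) * ind (T y ∧ H w y) + ind (y == w) * ind (T x ∧ H w x)))
    ≡⟨ sum₂-distrib-+ (λ x y → ind (T′ x ∧ T′ y ∧ H x y)) _ ⟩
      pairsIn H T′ + sum₂ (λ x y → ind (x == w) * ind (T y ∧ H w y) + ind (y == w) * ind (T x ∧ H w x))
    ≡⟨ cong (pairsIn H T′ +_) (sum₂-distrib-+ (λ x y → ind (x == w) * ind (T y ∧ H w y)) _) ⟩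
      pairsIn H T′ + (sum₂ (λ x y → ind (x == w) * ind (T y ∧ H w y)) + sum₂ (λ x y → ind (y == w) * ind (T x ∧ H w x)))
    ≡⟨ cong (λ z → pairsIn H T′ + (z + sum₂ (λ x y → ind (y == w) * ind (T x ∧ H w x)))) out-of-w ⟩
      pairsIn H T′ + (degIn H T w + sum₂ (λ x y → ind (y == w) * ind (T x ∧ H w x)))
    ≡⟨ cong (λ z → pairsIn H T′ + (degIn H T w + z)) (sum-cong-≗ {n} λ x → sum-indicator w (λ _ → ind (T x ∧ H w x))) ⟩
      pairsIn H T′ + (degIn H T w + degIn H T w)
    ∎
    where
    open ≡-Reasoning
    T′ = remove T w
    out-of-w : sum₂ (λ x y → ind (x == w) * ind (T y ∧ H w y)) ≡ degIn H T w
    out-of-w = trans (sum-cong-≗ {n} λ x → sym (*-distribˡ-sum (ind (x == w)) (λ y → ind (T y ∧ H w y))))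
                     (sum-indicator w (λ _ → degIn H T w))
    split : ∀ x y → ind (T x ∧ T y ∧ H x y) ≡
                    ind (T′ x ∧ T′ y ∧ H x y) + (ind (x == w) * ind (T y ∧ H w y) + ind (y == w) * ind (T x ∧ H w x))
    split x y with x ≟ w | y ≟ w
    ... | yes refl | yes refl rewrite w∈T | H-irrefl x = refl
    ... | yes refl | no _ rewrite w∈T = sym (trans (+-identityʳ _) (+-identityʳ _))
    ... | no _ | yes refl rewrite w∈T | H-sym x y | ∧-identityʳ (T x) | ∧-zeroʳ (T x) = sym (+-identityʳ _)
    ... | no _ | no _ rewrite ∧-identityʳ (T x) | ∧-identityʳ (T y) = sym (+-identityʳ _)

  degIn≤card-remove : ∀ (T : Subset n) (w : Fin n) → degIn H T w ≤ card (remove T w)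
  degIn≤card-remove T w = sum-mono-≤ neighbour
    where
    neighbour : ∀ y → ind (T y ∧ H w y) ≤ ind (T y ∧ not (y == w))
    neighbour y with y ≟ w
    ... | yes refl rewrite H-irrefl y | ∧-zeroʳ (T y) = z≤n
    ... | no _ rewrite ∧-identityʳ (T y) = both (T y) (H w y)
      where
      both : ∀ p q → ind (p ∧ q) ≤ ind p
      both true q = ind≤1 q
      both false q = z≤n

  -- Walk inside T, never returning to the previous vertex; minimum degree 2 makes this possible.
  minDegree≥2⇒cycle : ∀ (T : Subset n) (w₀ : Fin n) → T w₀ ≡ true → (∀ w → T w ≡ true → 2 ≤ degIn H T w) →
                      Cycle (λ x y → H x y ≡ true)
  minDegree≥2⇒cycle T w₀ w₀∈T deg≥2 =
    walk⇒cycle H f (λ m → proj₁ (proj₂ (move m))) (λ m → proj₂ (proj₂ (move (suc m)))) H-irrefl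
    where
    Continues : Fin n → Fin n → Fin n → Set
    Continues p c y = (T y ≡ true) × (H c y ≡ true) × (y ≢ p)
    continue : ∀ p c → T c ≡ true → Σ (Fin n) (Continues p c)
    continue p c c∈T with any? (λ y → (T y ≟ᵇ true) ×-dec ((H c y ≟ᵇ true) ×-dec ¬? (y ≟ p)))
    ... | yes found = found
    ... | no none =
      ⊥-elim (1+n≰n (≤-trans (deg≥2 c c∈T) (≤-trans (sum-mono-≤ only-p) (≤-reflexive (sum-indicator p (λ _ → 1))))))
      where
      only-p : ∀ y → ind (T y ∧ H c y) ≤ ind (y == p) * 1
      only-p y with y ≟ p | T y in y∈T | H c y in cy
      ... | yes refl | t | h = ind≤1 (t ∧ h)
      ... | no _ | false | _ = z≤n
      ... | no _ | true | false = z≤n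
      ... | no y≢p | true | true = ⊥-elim (none (y , y∈T , cy , y≢p))
    State : Set
    State = Σ (Fin n × Fin n) λ pc → T (proj₂ pc) ≡ true
    advance : State → State
    advance ((p , c) , c∈T) = let (y , y∈T , _) = continue p c c∈T in (c , y) , y∈T
    walk : ℕ → State
    walk zero = (w₀ , w₀) , w₀∈T
    walk (suc m) = advance (walk m)
    f : ℕ → Fin n
    f m = proj₂ (proj₁ (walk m))
    move : ∀ m → Continues (proj₁ (proj₁ (walk m))) (f m) (f (suc m))
    move m = proj₂ (continue (proj₁ (proj₁ (walk m))) (f m) (proj₂ (walk m)))

  module _ (acyclic : ¬ Cycle (λ x y → H x y ≡ true)) where

    leaf : ∀ (T : Subset n) (w₀ : Fin n) → T w₀ ≡ true → ∃ λ w → (T w ≡ true) × (degIn H T w ≤ 1)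
    leaf T w₀ w₀∈T with any? (λ w → (T w ≟ᵇ true) ×-dec (degIn H T w ≤? 1))
    ... | yes found = found
    ... | no none = ⊥-elim (acyclic (minDegree≥2⇒cycle T w₀ w₀∈T λ w w∈T → ≰⇒> (λ deg≤1 → none (w , w∈T , deg≤1))))

    pairsIn-acyclic : ∀ k (T : Subset n) → card T ≡ k → pairsIn H T ≤ 2 * (k ∸ 1)
    pairsIn-acyclic zero T |T|≡0 = ≤-reflexive (pairsIn-empty H T |T|≡0)
    pairsIn-acyclic (suc k) T |T|≡1+k with card-pos⇒member T (subst (0 <_) (sym |T|≡1+k) (s≤s z≤n))
    ... | w₀ , w₀∈T with leaf T w₀ w₀∈T
    ... | w , w∈T , deg≤1 = begin
        pairsIn H T
      ≡⟨ pairsIn-remove T w w∈T ⟩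
        pairsIn H T′ + (degIn H T w + degIn H T w)
      ≤⟨ leaf-removal k (pairsIn-acyclic k T′ |T′|≡k) deg≤1 (≤-trans (degIn≤card-remove T w) (≤-reflexive |T′|≡k)) ⟩
        2 * k
      ∎
      where
      open ≤-Reasoning
      T′ = remove T w
      |T′|≡k : card T′ ≡ k
      |T′|≡k = suc-injective (trans (sym (card-remove T w w∈T)) |T|≡1+k)
      leaf-removal : ∀ k {p e} → p ≤ 2 * (k ∸ 1) → e ≤ 1 → e ≤ k → p + (e + e) ≤ 2 * k
      leaf-removal zero {p} p≤0 _ z≤n = ≤-trans (≤-reflexive (+-identityʳ p)) p≤0
      leaf-removal (suc k) {p} {e} p≤2k e≤1 _ =
        ≤-trans (+-mono-≤ p≤2k (+-mono-≤ e≤1 e≤1)) (≤-reflexive (arith k))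
        where
        arith : ∀ k → 2 * k + (1 + 1) ≡ 2 * suc k
        arith = solve-∀

Sparse : ∀ {n} → ℕ → Graph n → Set
Sparse {n} α G = ∀ (T : Subset n) → pairsIn G T ≤ α * (2 * (card T ∸ 1))

arboricity⇒sparse : ∀ {n α} (G : Graph n) → ArboricityAtMost α G → (∀ x y → G x y ≡ G y x) → (∀ x → G x x ≡ false) →
                    Sparse α G
arboricity⇒sparse {n} {α} G (col , col-sym , forests) G-sym G-irrefl T = begin
    pairsIn G T
  ≡⟨ by-colour ⟩
    sum (λ c → pairsIn (H c) T)
  ≤⟨ sum-mono-≤ (λ c → pairsIn-acyclic (H c) (H-sym c) (H-irrefl c) (acyclic c) (card T) T refl) ⟩
    sum {α} (λ _ → 2 * (card T ∸ 1))
  ≡⟨ sum-const {α} (2 * (card T ∸ 1)) ⟩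
    α * (2 * (card T ∸ 1))
  ∎
  where
  open ≤-Reasoning
  H : Fin α → Graph n
  H c x y = G x y ∧ (col x y == c)
  H-sym : ∀ c x y → H c x y ≡ H c y x
  H-sym c x y rewrite G-sym x y | col-sym x y = refl
  H-irrefl : ∀ c x → H c x x ≡ false
  H-irrefl c x rewrite G-irrefl x = refl
  acyclic : ∀ c → ¬ Cycle (λ x y → H c x y ≡ true)
  acyclic c cyc = forests c (record { k = Cycle.k cyc ; vs = Cycle.vs cyc ; inj = Cycle.inj cyc
                                    ; adj = λ i → coloured (Cycle.adj cyc i) ; close = coloured (Cycle.close cyc) })
    where
    coloured : ∀ {x y} → H c x y ≡ true → (G x y ≡ true) × (col x y ≡ c)
    coloured {x} {y} e with ∧-true {G x y} e
    ... | Gxy , col≡c = Gxy , ==⇒≡ col≡c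
  one-colour : ∀ x y → ind (T x ∧ T y ∧ G x y) ≡ sum (λ c → ind (T x ∧ T y ∧ H c x y))
  one-colour x y with T x | T y | G x y
  ... | true | true | true =
    sym (trans (sum-cong-≗ {α} λ c → sym (*-identityʳ (ind (col x y == c)))) (sum-indicator′ (col x y) (λ _ → 1)))
  ... | true | true | false = sym (sum-replicate-zero α)
  ... | true | false | _ = sym (sum-replicate-zero α)
  ... | false | _ | _ = sym (sum-replicate-zero α)
  by-colour : pairsIn G T ≡ sum (λ c → pairsIn (H c) T)
  by-colour = trans (sum₂-cong one-colour)
                (trans (sum-cong-≗ {n} (λ x → ∑-comm (λ y c → ind (T x ∧ T y ∧ H c x y))))
                       (∑-comm (λ x c → sum (λ y → ind (T x ∧ T y ∧ H c x y)))))

-- Restoring a good orientation after an insertion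

anyFin : ∀ {n} → (Fin n → Bool) → Bool
anyFin {zero} P = false
anyFin {suc n} P = P zero ∨ anyFin (λ i → P (suc i))

anyFin-intro : ∀ {n} (P : Fin n → Bool) (x : Fin n) → P x ≡ true → anyFin P ≡ true
anyFin-intro P zero Px rewrite Px = refl
anyFin-intro P (suc x) Px rewrite anyFin-intro (λ i → P (suc i)) x Px = ∨-comm (P zero) true

anyFin-elim : ∀ {n} (P : Fin n → Bool) → anyFin P ≡ true → ∃ λ x → P x ≡ true
anyFin-elim {suc n} P any with P zero in P0
... | true = zero , P0
... | false with anyFin-elim (λ i → P (suc i)) any
...   | x , Px = suc x , Px

reach : ∀ {n} → Digraph n → Fin n → ℕ → Subset n
reach a u zero y = y == u
reach a u (suc i) y = reach a u i y ∨ anyFin (λ x → reach a u i x ∧ a x y)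

module _ {n : ℕ} (a : Digraph n) (u : Fin n) where

  reach-source : ∀ i → reach a u i u ≡ true
  reach-source zero = ==-refl u
  reach-source (suc i) rewrite reach-source i = refl

  unreached⇒≢source : ∀ i {z} → reach a u i z ≡ false → z ≢ u
  unreached⇒≢source i z∉N refl = true≢false (reach-source i) z∉N

  reach-suc : ∀ i y → reach a u i y ≡ true → reach a u (suc i) y ≡ true
  reach-suc i y y∈N rewrite y∈N = refl

  reach-mono : ∀ {j k} → j ≤ k → ∀ y → reach a u j y ≡ true → reach a u k y ≡ true
  reach-mono {k = zero} z≤n y y∈N = y∈N
  reach-mono {k = suc k} j≤1+k y y∈N with m≤n⇒m<n∨m≡n j≤1+k
  ... | inj₁ j<1+k = reach-suc k y (reach-mono (≤-pred j<1+k) y y∈N)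
  ... | inj₂ refl = y∈N

  reach-arc : ∀ i x y → reach a u i x ≡ true → a x y ≡ true → reach a u (suc i) y ≡ true
  reach-arc i x y x∈N axy rewrite anyFin-intro (λ w → reach a u i w ∧ a w y) x (cong₂ _∧_ x∈N axy) =
    ∨-comm (reach a u i y) true

  reach-suc-inv : ∀ i y → reach a u (suc i) y ≡ true →
                  (reach a u i y ≡ true) ⊎ ∃ λ x → (reach a u i x ≡ true) × (a x y ≡ true)
  reach-suc-inv i y y∈N with ∨-true {reach a u i y} y∈N
  ... | inj₁ y∈Nᵢ = inj₁ y∈Nᵢ
  ... | inj₂ via with anyFin-elim (λ x → reach a u i x ∧ a x y) via
  ...   | x , x∈N∧axy = inj₂ (x , ∧-true {reach a u i x} x∈N∧axy)

reach-flipArc : ∀ {n} (a : Digraph n) (u x z : Fin n) {i : ℕ} → reach a u i z ≡ false →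
                ∀ {j} → j ≤ i → ∀ y → reach a u j y ≡ true → reach (flipArc a x z) u j y ≡ true
reach-flipArc a u x z z∉N {zero} _ y y∈N = y∈N
reach-flipArc a u x z {i} z∉N {suc j} 1+j≤i y y∈N with reach-suc-inv a u j y y∈N
... | inj₁ y∈Nⱼ = reach-suc (flipArc a x z) u j y (reach-flipArc a u x z {i} z∉N (<⇒≤ 1+j≤i) y y∈Nⱼ)
... | inj₂ (w , w∈Nⱼ , awy) =
  reach-arc (flipArc a x z) u j w y (reach-flipArc a u x z {i} z∉N (<⇒≤ 1+j≤i) w w∈Nⱼ) kept
  where
  kept : flipArc a x z w y ≡ true
  kept with (w == x) ∧ (y == z) in flipped
  ... | false rewrite awy = refl
  ... | true with pair-== {x = w} flipped
  ...   | _ , refl = ⊥-elim (true≢false (reach-mono a u 1+j≤i z y∈N) z∉N)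

module _ {n : ℕ} (a : Digraph n) {x z : Fin n} (axz : a x z ≡ true) (x≢z : x ≢ z) where

  outdeg-flipArc-head : outdeg (flipArc a x z) z ≤ suc (outdeg a z)
  outdeg-flipArc-head = begin
      outdeg (flipArc a x z) z            ≤⟨ m≤m+n _ (ind (z == x)) ⟩
      outdeg (flipArc a x z) z + ind (z == x) ≤⟨ outdeg-flipArc a axz x≢z z ⟩
      outdeg a z + ind (z == z)           ≡⟨ cong (λ b → outdeg a z + ind b) (==-refl z) ⟩
      outdeg a z + 1                      ≡⟨ +-comm (outdeg a z) 1 ⟩
      suc (outdeg a z)                    ∎
    where open ≤-Reasoning

  outdeg-flipArc-tail : suc (outdeg (flipArc a x z) x) ≤ outdeg a x
  outdeg-flipArc-tail = begin
      suc (outdeg (flipArc a x z) x)          ≡⟨ +-comm 1 _ ⟩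
      outdeg (flipArc a x z) x + 1            ≡⟨ cong (λ b → outdeg (flipArc a x z) x + ind b) (sym (==-refl x)) ⟩
      outdeg (flipArc a x z) x + ind (x == x) ≤⟨ outdeg-flipArc a axz x≢z x ⟩
      outdeg a x + ind (x == z)               ≡⟨ cong (λ b → outdeg a x + ind b) (≢⇒==false x≢z) ⟩
      outdeg a x + 0                          ≡⟨ +-identityʳ _ ⟩
      outdeg a x                              ∎
    where open ≤-Reasoning

  outdeg-flipArc-other : ∀ w → w ≢ z → outdeg (flipArc a x z) w ≤ outdeg a w
  outdeg-flipArc-other w w≢z = begin
      outdeg (flipArc a x z) w                ≤⟨ m≤m+n _ (ind (w == x)) ⟩
      outdeg (flipArc a x z) w + ind (w == x) ≤⟨ outdeg-flipArc a axz x≢z w ⟩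
      outdeg a w + ind (w == z)               ≡⟨ cong (λ b → outdeg a w + ind b) (≢⇒==false w≢z) ⟩
      outdeg a w + 0                          ≡⟨ +-identityʳ _ ⟩
      outdeg a w                              ∎
    where open ≤-Reasoning

module _ {n : ℕ} (G : Graph n) (δ : ℕ) (u : Fin n) where

  AlmostGood : Digraph n → Set
  AlmostGood a = IsOrientation G a × (∀ w → w ≢ u → outdeg a w ≤ δ) × (outdeg a u ≤ suc δ)

  flipArc-source-good : ∀ {a z} → AlmostGood a → a u z ≡ true → outdeg a z < δ → GoodOrientation δ G (flipArc a u z)
  flipArc-source-good {a} {z} (o , bounded , u≤1+δ) auz z<δ = isOrientation-flipArc o auz , good
    where
    good : ∀ w → outdeg (flipArc a u z) w ≤ δ
    good w with ≡-or-≢ w z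
    ... | inj₁ refl = ≤-trans (outdeg-flipArc-head a auz (arc⇒≢ o auz)) z<δ
    ... | inj₂ w≢z with ≡-or-≢ w u
    ...   | inj₁ refl = ≤-pred (≤-trans (outdeg-flipArc-tail a auz (arc⇒≢ o auz)) u≤1+δ)
    ...   | inj₂ w≢u = ≤-trans (outdeg-flipArc-other a auz (arc⇒≢ o auz) w w≢z) (bounded w w≢u)

  flipArc-almostGood : ∀ {a x z} → AlmostGood a → a x z ≡ true → outdeg a z < δ → z ≢ u → AlmostGood (flipArc a x z)
  flipArc-almostGood {a} {x} {z} (o , bounded , u≤1+δ) axz z<δ z≢u =
    isOrientation-flipArc o axz , bounded′ , ≤-trans (outdeg-flipArc-other a axz x≢z u (λ u≡z → z≢u (sym u≡z))) u≤1+δ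
    where
    x≢z = arc⇒≢ o axz
    bounded′ : ∀ w → w ≢ u → outdeg (flipArc a x z) w ≤ δ
    bounded′ w w≢u with ≡-or-≢ w z
    ... | inj₁ refl = ≤-trans (outdeg-flipArc-head a axz x≢z) z<δ
    ... | inj₂ w≢z = ≤-trans (outdeg-flipArc-other a axz x≢z w w≢z) (bounded w w≢u)

  -- Flip the last arc x → z of a path from u to z; then x has out-degree below δ and is one layer closer to u.
  reversePath : ∀ i (a : Digraph n) → AlmostGood a → ∀ z → reach a u i z ≡ true → outdeg a z < δ →
                Σ (Digraph n) λ a′ → GoodOrientation δ G a′ × dist a′ a ≤ i
  reversePath zero a (o , bounded , _) z z=u z<δ with ==⇒≡ z=u
  ... | refl = a , (o , good) , ≤-reflexive (dist-self a)
    where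
    good : ∀ w → outdeg a w ≤ δ
    good w with ≡-or-≢ w z
    ... | inj₁ refl = <⇒≤ z<δ
    ... | inj₂ w≢z = bounded w w≢z
  reversePath (suc i) a almost z z∈N z<δ with reach a u i z in z∈Nᵢ?
  ... | true with reversePath i a almost z z∈Nᵢ? z<δ
  ...   | a′ , good , d = a′ , good , m≤n⇒m≤1+n d
  reversePath (suc i) a almost@(o , bounded , _) z z∈N z<δ | false
    with x , x∈Nᵢ∧axz ← anyFin-elim (λ x → reach a u i x ∧ a x z) z∈N
    with x∈Nᵢ , axz ← ∧-true {reach a u i x} x∈Nᵢ∧axz
    with x ≟ u
  ...   | yes refl = flipArc a x z , flipArc-source-good almost axz z<δ , ≤-trans (dist-flipArc a x z) (s≤s z≤n)
  ...   | no x≢u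
    with a″ , good , d ← reversePath i (flipArc a x z) (flipArc-almostGood almost axz z<δ (unreached⇒≢source a u i z∈Nᵢ?)) x
                           (reach-flipArc a u x z {i} z∈Nᵢ? ≤-refl x x∈Nᵢ)
                           (≤-trans (outdeg-flipArc-tail a axz (arc⇒≢ o axz)) (bounded x x≢u))
    = a″ , good , ≤-trans (dist-triangle a″ (flipArc a x z) a)
                    (≤-trans (+-mono-≤ d (dist-flipArc a x z)) (≤-reflexive (+-comm i 1)))

module _ {n : ℕ} {G : Graph n} {δ α : ℕ} .{{_ : NonZero α}} (sparse : Sparse α G)
         {a : Digraph n} (o : IsOrientation G a) (u : Fin n) where

  arcsIn : Subset n → ℕ
  arcsIn T = sum₂ (λ x y → ind (T x ∧ T y ∧ a x y))

  pairsIn≡2*arcsIn : ∀ T → pairsIn G T ≡ 2 * arcsIn T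
  pairsIn≡2*arcsIn T = begin
      pairsIn G T
    ≡⟨ sym (sum₂-cong (λ x y → one-way (T x) (T y) (a x y) (a y x) (G x y) (o x y))) ⟩
      sum₂ (λ x y → ind (T x ∧ T y ∧ a x y) + ind (T y ∧ T x ∧ a y x))
    ≡⟨ sum₂-distrib-+ (λ x y → ind (T x ∧ T y ∧ a x y)) (λ x y → ind (T y ∧ T x ∧ a y x)) ⟩
      arcsIn T + sum₂ (λ x y → ind (T y ∧ T x ∧ a y x))
    ≡⟨ cong (arcsIn T +_) (sym (∑-comm (λ x y → ind (T x ∧ T y ∧ a x y)))) ⟩
      arcsIn T + arcsIn T
    ≡⟨ cong (arcsIn T +_) (sym (+-identityʳ (arcsIn T))) ⟩
      2 * arcsIn T
    ∎
    where
    open ≡-Reasoning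
    one-way : ∀ s t p q g → Oriented p q g → ind (s ∧ t ∧ p) + ind (t ∧ s ∧ q) ≡ ind (s ∧ t ∧ g)
    one-way true true true false g refl = refl
    one-way true true false true g refl = refl
    one-way true true false false g refl = refl
    one-way true false p q g _ = refl
    one-way false true p q g _ = refl
    one-way false false p q g _ = refl

  card-reach-pos : ∀ i → 1 ≤ card (reach a u i)
  card-reach-pos i = ≤-trans (≤-reflexive (cong ind (sym (reach-source a u i)))) (term≤sum (λ y → ind (reach a u i y)) u)

  -- All out-arcs of a saturated layer stay within the next layer, which is sparse.
  reach-growth : ∀ i → (∀ z → reach a u i z ≡ true → δ ≤ outdeg a z) →
                 δ * card (reach a u i) < α * card (reach a u (suc i))
  reach-growth i saturated = begin-strict
      δ * card (reach a u i)
    ≡⟨ *-distribˡ-sum δ (λ z → ind (reach a u i z)) ⟩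
      sum (λ z → δ * ind (reach a u i z))
    ≤⟨ sum-mono-≤ out-arcs ⟩
      sum₂ (λ x y → ind (reach a u i x ∧ a x y))
    ≤⟨ sum₂-mono-≤ inside ⟩
      arcsIn N
    ≤⟨ *-cancelˡ-≤ 2 twice ⟩
      α * (card N ∸ 1)
    <⟨ *-monoʳ-< α (∸-monoʳ-< z<s (card-reach-pos (suc i))) ⟩
      α * card N
    ∎
    where
    open ≤-Reasoning
    N = reach a u (suc i)
    out-arcs : ∀ z → δ * ind (reach a u i z) ≤ sum (λ y → ind (reach a u i z ∧ a z y))
    out-arcs z with reach a u i z in z∈Nᵢ
    ... | true = ≤-trans (≤-reflexive (*-identityʳ δ)) (saturated z z∈Nᵢ)
    ... | false = ≤-trans (≤-reflexive (*-zeroʳ δ)) z≤n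
    inside : ∀ x y → ind (reach a u i x ∧ a x y) ≤ ind (N x ∧ N y ∧ a x y)
    inside x y with reach a u i x in x∈Nᵢ | a x y in axy
    ... | true | true rewrite reach-arc a u i x y x∈Nᵢ axy = ≤-refl
    ... | true | false = z≤n
    ... | false | _ = z≤n
    twice : 2 * arcsIn N ≤ 2 * (α * (card N ∸ 1))
    twice = begin
      2 * arcsIn N               ≡⟨ sym (pairsIn≡2*arcsIn N) ⟩
      pairsIn G N                ≤⟨ sparse N ⟩
      α * (2 * (card N ∸ 1))     ≡⟨ x∙yz≈y∙xz α 2 (card N ∸ 1) ⟩
      2 * (α * (card N ∸ 1))     ∎

  module _ (L : ℕ) (saturated : ∀ i → i < L → ∀ z → reach a u i z ≡ true → δ ≤ outdeg a z) where

    reach-power : ∀ i → i ≤ L → δ ^ i ≤ α ^ i * card (reach a u i)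
    reach-power-strict : ∀ i → i < L → δ ^ suc i < α ^ suc i * card (reach a u (suc i))

    reach-power zero _ = ≤-trans (card-reach-pos 0) (≤-reflexive (sym (+-identityʳ _)))
    reach-power (suc i) 1+i≤L = <⇒≤ (reach-power-strict i 1+i≤L)

    reach-power-strict i i<L = begin-strict
        δ * δ ^ i
      ≤⟨ *-monoʳ-≤ δ (reach-power i (<⇒≤ i<L)) ⟩
        δ * (α ^ i * card (reach a u i))
      ≡⟨ x∙yz≈y∙xz δ (α ^ i) _ ⟩
        α ^ i * (δ * card (reach a u i))
      <⟨ *-monoʳ-< (α ^ i) {{m^n≢0 α i}} (reach-growth i (saturated i i<L)) ⟩
        α ^ i * (α * card (reach a u (suc i)))
      ≡⟨ sym (*-assoc (α ^ i) α _) ⟩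
        α ^ i * α * card (reach a u (suc i))
      ≡⟨ cong (_* card (reach a u (suc i))) (*-comm (α ^ i) α) ⟩
        α * α ^ i * card (reach a u (suc i))
      ∎
      where open ≤-Reasoning

  deficientLayer? : ∀ L → (Σ ℕ λ i → i < L × ∃ λ z → (reach a u i z ≡ true) × (outdeg a z < δ)) ⊎
                          (∀ i → i < L → ∀ z → reach a u i z ≡ true → δ ≤ outdeg a z)
  deficientLayer? zero = inj₂ (λ _ ())
  deficientLayer? (suc L) with deficientLayer? L
  ... | inj₁ (i , i<L , found) = inj₁ (i , m<n⇒m<1+n i<L , found)
  ... | inj₂ saturated with any? (λ z → (reach a u L z ≟ᵇ true) ×-dec (outdeg a z <? δ))
  ...   | yes found = inj₁ (L , n<1+n L , found)
  ...   | no none = inj₂ λ i i<1+L z z∈N →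
            [ (λ i<L → saturated i i<L z z∈N) , (λ { refl → ≮⇒≥ (λ z<δ → none (z , z∈N , z<δ)) }) ]′
            (m<1+n⇒m<n∨m≡n i<1+L)

  deficient-within : ∀ L → α ^ suc L * n ≤ δ ^ suc L →
                     Σ ℕ λ i → i < suc L × ∃ λ z → (reach a u i z ≡ true) × (outdeg a z < δ)
  deficient-within L small with deficientLayer? (suc L)
  ... | inj₁ found = found
  ... | inj₂ saturated = ⊥-elim (<-irrefl refl (begin-strict
      δ ^ suc L                                <⟨ reach-power-strict (suc L) saturated L ≤-refl ⟩
      α ^ suc L * card (reach a u (suc L))     ≤⟨ *-monoʳ-≤ (α ^ suc L) (card≤n _) ⟩
      α ^ suc L * n                            ≤⟨ small ⟩
      δ ^ suc L                                ∎))
    where open ≤-Reasoning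

addArc-almostGood : ∀ {n δ} {G : Graph n} {O : Digraph n} {u v : Fin n} → GoodOrientation δ G O → G u v ≡ false → u ≢ v →
                    AlmostGood (withEdge u v G) δ u (addArc O u v)
addArc-almostGood {δ = δ} {O = O} {u} {v} (o , bounded) Guv u≢v =
  isOrientation-addArc o Guv u≢v ,
  (λ w w≢u → ≤-trans (outdeg-addArc O u v w)
               (≤-trans (≤-reflexive (trans (cong (λ b → outdeg O w + ind b) (≢⇒==false w≢u)) (+-identityʳ _))) (bounded w))) ,
  ≤-trans (outdeg-addArc O u v u)
    (≤-trans (≤-reflexive (trans (cong (λ b → outdeg O u + ind b) (==-refl u)) (+-comm (outdeg O u) 1))) (s≤s (bounded u)))

distinct⇒2≤n : ∀ {n} {u v : Fin n} → u ≢ v → 2 ≤ n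
distinct⇒2≤n {suc zero} {zero} {zero} u≢v = ⊥-elim (u≢v refl)
distinct⇒2≤n {suc (suc n)} _ = s≤s (s≤s z≤n)

reorient : ∀ {n δ α} {G : Graph n} {O : Digraph n} (L : ℕ) (u v : Fin n) →
           GoodOrientation δ G O → G u v ≡ false → u ≢ v → 0 < α → Sparse α (withEdge u v G) → α ^ L * n ≤ δ ^ L →
           Σ (Digraph n) λ O′ → GoodOrientation δ (withEdge u v G) O′ × dist O′ O ≤ L
reorient zero u v _ _ u≢v _ _ n≤1 = ⊥-elim (1+n≰n (≤-trans (distinct⇒2≤n u≢v) (≤-trans (m≤m+n _ 0) n≤1)))
reorient {δ = δ} {G = G} {O} (suc L) u v good Guv u≢v 0<α sparse small
  with i , i<1+L , z , z∈N , z<δ ← deficient-within {{>-nonZero 0<α}} sparse (isOrientation-addArc (proj₁ good) Guv u≢v) u L small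
  with O′ , good′ , d ← reversePath (withEdge u v G) δ u i (addArc O u v) (addArc-almostGood good Guv u≢v) z z∈N z<δ
  = O′ , good′ , ≤-trans (dist-triangle O′ (addArc O u v) O)
                   (≤-trans (+-mono-≤ d (≤-trans (dist-addArc O O u v) (≤-reflexive (cong (_+ 1) (dist-self O)))))
                            (≤-trans (≤-reflexive (+-comm i 1)) i<1+L))

-- Cost of the repair loop

+-≤-cancel-through : ∀ x y z w u k → x + y ≤ z + w → u + w ≤ k + y → x + u ≤ z + k
+-≤-cancel-through x y z w u k x+y≤z+w u+w≤k+y = +-cancelʳ-≤ w (x + u) (z + k) (begin
    x + u + w      ≡⟨ +-assoc x u w ⟩
    x + (u + w)    ≤⟨ +-monoʳ-≤ x u+w≤k+y ⟩
    x + (k + y)    ≡⟨ regroup x k y ⟩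
    x + y + k      ≤⟨ +-monoˡ-≤ k x+y≤z+w ⟩
    z + w + k      ≡⟨ trans (+-assoc z w k) (regroup z w k) ⟩
    z + k + w      ∎)
  where
  open ≤-Reasoning
  regroup : ∀ a b c → a + (b + c) ≡ a + c + b
  regroup a b c = trans (cong (a +_) (+-comm b c)) (sym (+-assoc a c b))

-- With A + B ≥ D + 2δ arcs of which A ≤ δ agree with O, the reversal frees enough potential to pay for itself.
reversal-arith : ∀ A B δ D → A ≤ δ → D + 2 * δ ≤ A + B → (A + B) * D + (D + 2 * δ) * A ≤ (D + 2 * δ) * B
reversal-arith A B δ D A≤δ many = +-cancelʳ-≤ (2 * (δ * A)) _ _ (begin
    (A + B) * D + (D + 2 * δ) * A + 2 * (δ * A)   ≡⟨ lhs A B δ D ⟩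
    2 * (A * (D + 2 * δ)) + B * D                 ≤⟨ +-monoˡ-≤ (B * D) (*-monoʳ-≤ 2 agree-bound) ⟩
    2 * (δ * (A + B)) + B * D                     ≡⟨ rhs A B δ D ⟩
    (D + 2 * δ) * B + 2 * (δ * A)                 ∎)
  where
  open ≤-Reasoning
  agree-bound : A * (D + 2 * δ) ≤ δ * (A + B)
  agree-bound = *-mono-≤ A≤δ many
  lhs : ∀ A B δ D → (A + B) * D + (D + 2 * δ) * A + 2 * (δ * A) ≡ 2 * (A * (D + 2 * δ)) + B * D
  lhs = solve-∀
  rhs : ∀ A B δ D → 2 * (δ * (A + B)) + B * D ≡ (D + 2 * δ) * B + 2 * (δ * A)
  rhs = solve-∀

insertion-arith : ∀ A B δ D d → A ≤ δ → 1 ≤ δ → D + 2 * δ ≡ suc d →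
                  (1 + (A + B)) * D + (suc d + suc d * A) ≤ 4 * (δ * suc d) + suc d * B
insertion-arith A B δ D d A≤δ 1≤δ D+2δ≡1+d = begin
    (1 + (A + B)) * D + (suc d + suc d * A)
  ≡⟨ expand A B D (suc d) ⟩
    (1 + A) * D + (1 + A) * suc d + B * D
  ≤⟨ +-mono-≤ (+-mono-≤ (*-mono-≤ (s≤s A≤δ) D≤1+d) (*-monoˡ-≤ (suc d) (s≤s A≤δ))) (*-monoʳ-≤ B D≤1+d) ⟩
    (1 + δ) * suc d + (1 + δ) * suc d + B * suc d
  ≡⟨ collect δ B (suc d) ⟩
    2 * ((1 + δ) * suc d) + suc d * B
  ≤⟨ +-monoˡ-≤ (suc d * B) (*-monoʳ-≤ 2 (*-monoˡ-≤ (suc d) (+-monoˡ-≤ δ 1≤δ))) ⟩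
    2 * ((δ + δ) * suc d) + suc d * B
  ≡⟨ cong (_+ suc d * B) (double δ (suc d)) ⟩
    4 * (δ * suc d) + suc d * B
  ∎
  where
  open ≤-Reasoning
  D≤1+d : D ≤ suc d
  D≤1+d = ≤-trans (m≤m+n D (2 * δ)) (≤-reflexive D+2δ≡1+d)
  expand : ∀ A B D e → (1 + (A + B)) * D + (e + e * A) ≡ (1 + A) * D + (1 + A) * e + B * D
  expand = solve-∀
  collect : ∀ δ B e → (1 + δ) * e + (1 + δ) * e + B * e ≡ 2 * ((1 + δ) * e) + e * B
  collect = solve-∀
  double : ∀ δ e → 2 * ((δ + δ) * e) ≡ 4 * (δ * e)
  double = solve-∀

module _ {n : ℕ} (d δ D : ℕ) (D+2δ≡1+d : D + 2 * δ ≡ suc d) {G : Graph n} {O : Digraph n} (good : GoodOrientation δ G O) where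

  reverseAll-potential : ∀ {s : Out n} (v : Fin n) → Represents G s →
                         let A = agreeOut (arcs s) O v ; B = disagreeOut (arcs s) O v in
                         (A ≤ δ) × (A + B ≡ length (s v)) ×
                         (suc d * dist (arcs (reverseAll s v)) O + suc d * B ≤ suc d * dist (arcs s) O + suc d * A)
  reverseAll-potential {s} v rep@(o , _) =
    ≤-trans (agreeOut≤outdeg (arcs s) O v) (proj₂ good v) ,
    trans (agreeOut+disagreeOut (arcs s) O v) (outdeg-arcs rep v) ,
    (begin
      suc d * dist (arcs (reverseAll s v)) O + suc d * B   ≡⟨ sym (*-distribˡ-+ (suc d) _ B) ⟩
      suc d * (dist (arcs (reverseAll s v)) O + B)         ≡⟨ cong (λ z → suc d * (z + B)) (dist-cong O (arcs-reverseAll s v)) ⟩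
      suc d * (dist (reverseAt (arcs s) v) O + B)          ≤⟨ *-monoʳ-≤ (suc d) (dist-reverseAt (arcs s) O v o (proj₁ good)) ⟩
      suc d * (dist (arcs s) O + A)                        ≡⟨ *-distribˡ-+ (suc d) (dist (arcs s) O) A ⟩
      suc d * dist (arcs s) O + suc d * A                  ∎)
    where
    open ≤-Reasoning
    A = agreeOut (arcs s) O v
    B = disagreeOut (arcs s) O v

  reverseAll-pays : ∀ {s : Out n} (v : Fin n) → Represents G s → d < length (s v) →
                    length (s v) * D + suc d * dist (arcs (reverseAll s v)) O ≤ suc d * dist (arcs s) O
  reverseAll-pays {s} v rep d<len with reverseAll-potential v rep
  ... | A≤δ , A+B≡len , potential =
    ≤-trans (≤-reflexive (+-comm (length (s v) * D) _))
            (≤-trans (+-≤-cancel-through (suc d * dist (arcs (reverseAll s v)) O) (suc d * B) (suc d * dist (arcs s) O) (suc d * A)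
                                                (length (s v) * D) 0 potential paid) (≤-reflexive (+-identityʳ _)))
    where
    A = agreeOut (arcs s) O v
    B = disagreeOut (arcs s) O v
    paid : length (s v) * D + suc d * A ≤ 0 + suc d * B
    paid = subst (λ e → length (s v) * D + e * A ≤ e * B) D+2δ≡1+d
             (subst (λ ℓ → ℓ * D + (D + 2 * δ) * A ≤ (D + 2 * δ) * B) A+B≡len
               (reversal-arith A B δ D A≤δ (subst (_≤ A + B) (sym D+2δ≡1+d) (subst (suc d ≤_) (sym A+B≡len) d<len))))

  flips-pay : ∀ {s s′ : Out n} {c : ℕ} → Represents G s → Flips d s s′ c →
              c * D + suc d * dist (arcs s′) O ≤ suc d * dist (arcs s) O
  flips-pay rep done = ≤-refl
  flips-pay {s} {s′} rep (step {c = c} v d<len rest) = begin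
      (length (s v) + c) * D + suc d * dist (arcs s′) O
    ≡⟨ cong (_+ suc d * dist (arcs s′) O) (*-distribʳ-+ D (length (s v)) c) ⟩
      length (s v) * D + c * D + suc d * dist (arcs s′) O
    ≡⟨ +-assoc (length (s v) * D) _ _ ⟩
      length (s v) * D + (c * D + suc d * dist (arcs s′) O)
    ≤⟨ +-monoʳ-≤ (length (s v) * D) (flips-pay (represents-reverseAll s v rep) rest) ⟩
      length (s v) * D + suc d * dist (arcs (reverseAll s v)) O
    ≤⟨ reverseAll-pays v rep d<len ⟩
      suc d * dist (arcs s) O
    ∎
    where open ≤-Reasoning

represents-flips : ∀ {n d c} {G : Graph n} {s s′ : Out n} → Represents G s → Flips d s s′ c → Represents G s′
represents-flips rep done = rep
represents-flips {s = s} rep (step v _ rest) = represents-flips (represents-reverseAll s v rep) rest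

length-addOut : ∀ {n} (s : Out n) (x y : Fin n) → length (addOut s x y x) ≡ suc (length (s x))
length-addOut s x y rewrite ==-refl x = refl

insertion-pays : ∀ {n} (d δ D : ℕ) → D + 2 * δ ≡ suc d → 1 ≤ δ → ∀ {G : Graph n} {O : Digraph n} {s : Out n} {x y : Fin n} →
                 GoodOrientation δ (withEdge x y G) O → Represents G s → G x y ≡ false → x ≢ y →
                 insStartCost s x * D + suc d * dist (arcs (reverseAll (addOut s x y) x)) O
                   ≤ suc d * dist (arcs s) O + 4 * (δ * suc d)
insertion-pays d δ D D+2δ≡1+d 1≤δ {O = O} {s} {x} {y} good rep Gxy x≢y =
  ≤-trans (≤-reflexive (+-comm (insStartCost s x * D) _))
          (+-≤-cancel-through (suc d * dist (arcs (reverseAll s₀ x)) O) (suc d * B) (suc d * dist (arcs s) O) (suc d + suc d * A)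
                                             (insStartCost s x * D) (4 * (δ * suc d)) potential′ paid)
  where
  rep₀ = represents-addOut s x y rep Gxy x≢y
  s₀ = addOut s x y
  A = agreeOut (arcs s₀) O x
  B = disagreeOut (arcs s₀) O x
  reversal = reverseAll-potential d δ D D+2δ≡1+d good x rep₀
  A≤δ : A ≤ δ
  A≤δ = proj₁ reversal
  A+B≡len : A + B ≡ length (s₀ x)
  A+B≡len = proj₁ (proj₂ reversal)
  potential : suc d * dist (arcs (reverseAll s₀ x)) O + suc d * B ≤ suc d * dist (arcs s₀) O + suc d * A
  potential = proj₂ (proj₂ reversal)
  added : suc d * dist (arcs s₀) O ≤ suc d * dist (arcs s) O + suc d
  added = begin
    suc d * dist (arcs s₀) O          ≡⟨ cong (suc d *_) (dist-cong O (arcs-addOut s x y)) ⟩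
    suc d * dist (addArc (arcs s) x y) O ≤⟨ *-monoʳ-≤ (suc d) (dist-addArc (arcs s) O x y) ⟩
    suc d * (dist (arcs s) O + 1)     ≡⟨ *-distribˡ-+ (suc d) _ 1 ⟩
    suc d * dist (arcs s) O + suc d * 1 ≡⟨ cong (suc d * dist (arcs s) O +_) (*-identityʳ (suc d)) ⟩
    suc d * dist (arcs s) O + suc d   ∎
    where open ≤-Reasoning
  potential′ : suc d * dist (arcs (reverseAll s₀ x)) O + suc d * B ≤ suc d * dist (arcs s) O + (suc d + suc d * A)
  potential′ = ≤-trans potential (≤-trans (+-monoˡ-≤ (suc d * A) added) (≤-reflexive (+-assoc _ (suc d) (suc d * A))))
  cost : insStartCost s x ≡ 1 + (A + B)
  cost = cong suc (trans (sym (length-addOut s x y)) (sym A+B≡len))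
  paid : insStartCost s x * D + (suc d + suc d * A) ≤ 4 * (δ * suc d) + suc d * B
  paid = subst (λ c → c * D + (suc d + suc d * A) ≤ 4 * (δ * suc d) + suc d * B) (sym cost)
               (insertion-arith A B δ D d A≤δ 1≤δ D+2δ≡1+d)

isEdge-irrefl : ∀ {n} {u v : Fin n} → u ≢ v → ∀ x → isEdge u v x x ≡ false
isEdge-irrefl {u = u} {v} u≢v x with ≡-or-≢ x u | ≡-or-≢ x v
... | inj₁ refl | inj₁ refl = ⊥-elim (u≢v refl)
... | inj₁ refl | inj₂ x≢v rewrite ≢⇒==false x≢v | ==-refl x = refl
... | inj₂ x≢u | _ rewrite ≢⇒==false x≢u = ∧-zeroʳ (x == v)

isEdge-swap : ∀ {n} (u v x y : Fin n) → isEdge u v x y ≡ isEdge v u x y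
isEdge-swap u v x y = ∨-comm ((x == u) ∧ (y == v)) ((x == v) ∧ (y == u))

isEdge⇒same-status : ∀ {n} {G : Graph n} {u v x y : Fin n} → (∀ x y → G x y ≡ G y x) → isEdge u v x y ≡ true → G x y ≡ G u v
isEdge⇒same-status {G = G} {u} {v} {x} {y} G-sym e with ∨-true {(x == u) ∧ (y == v)} e
... | inj₁ xy=uv with pair-== {x = x} xy=uv
...   | refl , refl = refl
isEdge⇒same-status {G = G} {u} {v} {x} {y} G-sym e | inj₂ xy=vu with pair-== {x = x} xy=vu
...   | refl , refl = G-sym v u

withEdge-withoutEdge : ∀ {n} {G : Graph n} {u v : Fin n} → (∀ x y → G x y ≡ G y x) → G u v ≡ true →
                       ∀ x y → withEdge u v (withoutEdge u v G) x y ≡ G x y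
withEdge-withoutEdge {u = u} {v} G-sym Guv x y with isEdge u v x y in e
... | false = refl
... | true = sym (trans (isEdge⇒same-status G-sym e) Guv)

withoutEdge-withEdge : ∀ {n} {G : Graph n} {u v : Fin n} → (∀ x y → G x y ≡ G y x) → G u v ≡ false →
                       ∀ x y → withoutEdge u v (withEdge u v G) x y ≡ G x y
withoutEdge-withEdge {u = u} {v} G-sym Guv x y with isEdge u v x y in e
... | false = refl
... | true = sym (trans (isEdge⇒same-status G-sym e) Guv)

graphOf-sym : ∀ {n α} {σ : Seq n} → Valid α σ → ∀ x y → graphOf σ x y ≡ graphOf σ y x
graphOf-sym [] x y = refl
graphOf-sym (ins {u = u} {v} valid _ _ _) x y rewrite isEdge-sym u v x y | graphOf-sym valid x y = refl
graphOf-sym (del {u = u} {v} valid _ _) x y rewrite isEdge-sym u v x y | graphOf-sym valid x y = refl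

graphOf-irrefl : ∀ {n α} {σ : Seq n} → Valid α σ → ∀ x → graphOf σ x x ≡ false
graphOf-irrefl [] x = refl
graphOf-irrefl (ins valid u≢v _ _) x rewrite isEdge-irrefl u≢v x = graphOf-irrefl valid x
graphOf-irrefl (del {u = u} {v} valid _ _) x rewrite graphOf-irrefl valid x = ∧-zeroʳ (not (isEdge u v x x))

edge⇒distinct : ∀ {n α} {σ : Seq n} {u v : Fin n} → Valid α σ → graphOf σ u v ≡ true → u ≢ v
edge⇒distinct valid Guv refl = true≢false Guv (graphOf-irrefl valid _)

sparse-cong : ∀ {n α} {G G′ : Graph n} → (∀ x y → G x y ≡ G′ x y) → Sparse α G → Sparse α G′
sparse-cong {α = α} G≡G′ sparse T = subst (_≤ α * (2 * (card T ∸ 1)))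
                                      (sum₂-cong λ x y → cong (λ b → ind (T x ∧ T y ∧ b)) (G≡G′ x y)) (sparse T)

graphOf-sparse : ∀ {n α} {σ : Seq n} → Valid α σ → Sparse α (graphOf σ)
graphOf-sparse {n} [] T = ≤-trans (≤-reflexive (trans (sum₂-cong λ x y → no-edge (T x) (T y)) (sum₂-zero {n}))) z≤n
  where
  no-edge : ∀ p q → ind (p ∧ q ∧ false) ≡ 0
  no-edge true true = refl
  no-edge true false = refl
  no-edge false q = refl
graphOf-sparse v@(ins _ _ _ arb) = arboricity⇒sparse _ arb (graphOf-sym v) (graphOf-irrefl v)
graphOf-sparse v@(del _ _ arb) = arboricity⇒sparse _ arb (graphOf-sym v) (graphOf-irrefl v)

goodOrientation-cong : ∀ {n δ} {G G′ : Graph n} {O : Digraph n} → (∀ x y → G x y ≡ G′ x y) →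
                       GoodOrientation δ G O → GoodOrientation δ G′ O
goodOrientation-cong G≡G′ (o , bounded) = isOrientation-cong (λ _ _ → refl) G≡G′ o , bounded

goodOrientation-dropEdge : ∀ {n δ} {G : Graph n} {O : Digraph n} (u v : Fin n) → GoodOrientation δ G O →
                           GoodOrientation δ (withoutEdge u v G) (dropEdge O u v)
goodOrientation-dropEdge {O = O} u v (o , bounded) =
  isOrientation-dropEdge u v o , λ w → ≤-trans (outdeg-dropEdge O u v w) (bounded w)

endpoints-new : ∀ {n} {G : Graph n} {u v x y : Fin n} → (∀ p q → G p q ≡ G q p) → G u v ≡ false → u ≢ v →
                Endpoints u v x y → (G x y ≡ false) × (x ≢ y) × (∀ p q → withEdge x y G p q ≡ withEdge u v G p q)
endpoints-new G-sym Guv u≢v (inj₁ (refl , refl)) = Guv , u≢v , λ _ _ → refl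
endpoints-new {G = G} {u} {v} G-sym Guv u≢v (inj₂ (refl , refl)) =
  trans (G-sym v u) Guv , (λ v≡u → u≢v (sym v≡u)) , λ p q → cong (_∨ G p q) (isEdge-swap v u p q)

deletion-arith : ∀ d D L k → 0 < d → k ≤ suc (d + d) → k * D + suc d * L ≤ 4 * (d * D + L * suc d)
deletion-arith d D L k 0<d k≤1+2d = begin
    k * D + suc d * L                     ≤⟨ +-mono-≤ (*-monoˡ-≤ D k≤4d) (≤-trans (≤-reflexive (*-comm (suc d) L)) (m≤n*m _ 4)) ⟩
    4 * d * D + 4 * (L * suc d)           ≡⟨ distribute d D L ⟩
    4 * (d * D + L * suc d)               ∎
  where
  open ≤-Reasoning
  k≤4d : k ≤ 4 * d
  k≤4d = ≤-trans k≤1+2d (≤-trans (+-monoˡ-≤ (d + d) (≤-trans 0<d (m≤m+n d (d + 0)))) (≤-reflexive (quadruple d)))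
    where
    quadruple : ∀ d → 2 * d + (d + d) ≡ 4 * d
    quadruple = solve-∀
  distribute : ∀ d D L → 4 * d * D + 4 * (L * suc d) ≡ 4 * (d * D + L * suc d)
  distribute = solve-∀

module Amortization {n : ℕ} (d δ α L D : ℕ) (D+2δ≡1+d : D + 2 * δ ≡ suc d)
                    (0<α : 0 < α) (0<δ : 0 < δ) (0<d : 0 < d) (small : α ^ L * n ≤ δ ^ L) where

  Budget : Seq n → ℕ
  Budget σ = 4 * (#ins σ * (δ * suc d) + #del σ * (d * D + L * suc d))

  Paid : Seq n → Out n → ℕ → Set
  Paid σ s c = ∀ O → GoodOrientation δ (graphOf σ) O → c * D + suc d * dist (arcs s) O ≤ Budget σ

  goodOrientation-exists : ∀ {σ : Seq n} → Valid α σ → Σ (Digraph n) (GoodOrientation δ (graphOf σ))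
  goodOrientation-exists [] = (λ _ _ → false) , (λ x y → refl) , λ w → ≤-trans (≤-reflexive (sum-replicate-zero n)) z≤n
  goodOrientation-exists valid@(ins {u = u} {v} valid₀ u≢v Guv _)
    with O , good ← goodOrientation-exists valid₀
    with O′ , good′ , _ ← reorient L u v good Guv u≢v 0<α (graphOf-sparse valid) small
    = O′ , good′
  goodOrientation-exists (del {u = u} {v} valid₀ _ _) with O , good ← goodOrientation-exists valid₀ =
    dropEdge O u v , goodOrientation-dropEdge u v good

  insertion-represents : ∀ {ρ : Seq n} {u v x y : Fin n} {s s′ : Out n} {c : ℕ} → Valid α (ρ ▷ ins u v) →
                         Represents (graphOf ρ) s → Endpoints u v x y → Flips d (reverseAll (addOut s x y) x) s′ c →
                         Represents (graphOf (ρ ▷ ins u v)) s′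
  insertion-represents {x = x} {y} {s} (ins valid u≢v Guv _) rep ends flips
    with Gxy , x≢y , same ← endpoints-new (graphOf-sym valid) Guv u≢v ends
    with o , distinct ← represents-flips (represents-reverseAll (addOut s x y) x (represents-addOut s x y rep Gxy x≢y)) flips
    = isOrientation-cong (λ _ _ → refl) same o , distinct

  insertion-paid : ∀ {ρ : Seq n} {u v x y : Fin n} {s s′ : Out n} {c c′ : ℕ} → Valid α (ρ ▷ ins u v) →
                   Represents (graphOf ρ) s → Paid ρ s c → Endpoints u v x y → Flips d (reverseAll (addOut s x y) x) s′ c′ →
                   Paid (ρ ▷ ins u v) s′ (c + (insStartCost s x + c′))
  insertion-paid {ρ} {u} {v} {x} {y} {s} {s′} {c} {c′} (ins valid u≢v Guv _) rep paid ends flips O good = begin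
      (c + (k + c′)) * D + suc d * dist (arcs s′) O
    ≡⟨ regroup c k c′ D (suc d * dist (arcs s′) O) ⟩
      c * D + (k * D + (c′ * D + suc d * dist (arcs s′) O))
    ≤⟨ +-monoʳ-≤ (c * D) (+-monoʳ-≤ (k * D) (flips-pay d δ D D+2δ≡1+d good-xy rep₁ flips)) ⟩
      c * D + (k * D + suc d * dist (arcs s₁) O)
    ≤⟨ +-monoʳ-≤ (c * D) (insertion-pays d δ D D+2δ≡1+d 0<δ good-xy rep Gxy x≢y) ⟩
      c * D + (suc d * dist (arcs s) O + 4 * (δ * suc d))
    ≤⟨ +-monoʳ-≤ (c * D) (+-monoˡ-≤ _ (*-monoʳ-≤ (suc d) (dist-antitoneʳ (arcs s) λ p q e → proj₁ (∧-true {O p q} e)))) ⟩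
      c * D + (suc d * dist (arcs s) O′ + 4 * (δ * suc d))
    ≡⟨ sym (+-assoc (c * D) _ _) ⟩
      c * D + suc d * dist (arcs s) O′ + 4 * (δ * suc d)
    ≤⟨ +-monoˡ-≤ _ (paid O′ good′) ⟩
      Budget ρ + 4 * (δ * suc d)
    ≡⟨ budget-ins (#ins ρ) (#del ρ) (δ * suc d) (d * D + L * suc d) ⟩
      Budget (ρ ▷ ins u v)
    ∎
    where
    open ≤-Reasoning
    k = insStartCost s x
    s₁ = reverseAll (addOut s x y) x
    Gρ = graphOf ρ
    new = endpoints-new (graphOf-sym valid) Guv u≢v ends
    Gxy = proj₁ new
    x≢y = proj₁ (proj₂ new)
    good-xy : GoodOrientation δ (withEdge x y Gρ) O
    good-xy = goodOrientation-cong (λ p q → sym (proj₂ (proj₂ new) p q)) good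
    rep₁ : Represents (withEdge x y Gρ) s₁
    rep₁ = represents-reverseAll (addOut s x y) x (represents-addOut s x y rep Gxy x≢y)
    O′ = dropEdge O u v
    good′ : GoodOrientation δ Gρ O′
    good′ = goodOrientation-cong (withoutEdge-withEdge (graphOf-sym valid) Guv) (goodOrientation-dropEdge u v good)
    regroup : ∀ c k c′ D z → (c + (k + c′)) * D + z ≡ c * D + (k * D + (c′ * D + z))
    regroup = solve-∀
    budget-ins : ∀ a b X Y → 4 * (a * X + b * Y) + 4 * X ≡ 4 * (suc a * X + b * Y)
    budget-ins = solve-∀

  deletion-paid : ∀ {ρ : Seq n} {u v : Fin n} {s : Out n} {c : ℕ} → Valid α (ρ ▷ del u v) → Settled d s → Paid ρ s c →
                  Paid (ρ ▷ del u v) (deleteEdge s u v) (c + delCost s u v)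
  deletion-paid {ρ} {u} {v} {s} {c} (del valid Guv _) settled paid O good = begin
      (c + k) * D + suc d * dist (arcs (deleteEdge s u v)) O
    ≤⟨ +-monoʳ-≤ ((c + k) * D) (*-monoʳ-≤ (suc d) dist-bound) ⟩
      (c + k) * D + suc d * (dist (arcs s) O′ + L)
    ≡⟨ regroup c k D (suc d) (dist (arcs s) O′) L ⟩
      (c * D + suc d * dist (arcs s) O′) + (k * D + suc d * L)
    ≤⟨ +-mono-≤ (paid O′ (goodOrientation-cong (withEdge-withoutEdge (graphOf-sym valid) Guv) good′))
                (deletion-arith d D L k 0<d (s≤s (+-mono-≤ (settled u) (settled v)))) ⟩
      Budget ρ + 4 * (d * D + L * suc d)
    ≡⟨ budget-del (#ins ρ) (#del ρ) (δ * suc d) (d * D + L * suc d) ⟩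
      Budget (ρ ▷ del u v)
    ∎
    where
    open ≤-Reasoning
    k = delCost s u v
    u≢v = edge⇒distinct valid Guv
    Guv-gone : withoutEdge u v (graphOf ρ) u v ≡ false
    Guv-gone rewrite ==-refl u | ==-refl v = refl
    reoriented = reorient L u v good Guv-gone u≢v 0<α
                   (sparse-cong {α = α} (λ x y → sym (withEdge-withoutEdge (graphOf-sym valid) Guv x y)) (graphOf-sparse valid)) small
    O′ = proj₁ reoriented
    good′ = proj₁ (proj₂ reoriented)
    close : dist O′ O ≤ L
    close = proj₂ (proj₂ reoriented)
    deleted⊆ : ∀ x y → arcs (deleteEdge s u v) x y ≡ true → arcs s x y ≡ true
    deleted⊆ x y e = proj₁ (∧-true {arcs s x y} (trans (sym (arcs-deleteEdge s u v x y u≢v)) e))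
    dist-bound : dist (arcs (deleteEdge s u v)) O ≤ dist (arcs s) O′ + L
    dist-bound = begin
      dist (arcs (deleteEdge s u v)) O   ≤⟨ dist-monoˡ O deleted⊆ ⟩
      dist (arcs s) O                    ≤⟨ dist-triangle (arcs s) O′ O ⟩
      dist (arcs s) O′ + dist O′ O       ≤⟨ +-monoʳ-≤ (dist (arcs s) O′) close ⟩
      dist (arcs s) O′ + L               ∎
    regroup : ∀ c k D e f g → (c + k) * D + e * (f + g) ≡ (c * D + e * f) + (k * D + e * g)
    regroup = solve-∀
    budget-del : ∀ a b X Y → 4 * (a * X + b * Y) + 4 * Y ≡ 4 * (a * X + suc b * Y)
    budget-del = solve-∀

  run-invariant : ∀ {σ : Seq n} {s : Out n} {c : ℕ} → Valid α σ → Run d σ s c →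
                  Represents (graphOf σ) s × Settled d s × Paid σ s c
  run-invariant [] start = ((λ x y → refl) , (λ w → tt)) , (λ w → z≤n) ,
    λ O _ → ≤-trans (≤-reflexive (trans (cong (suc d *_) (sum₂-zero {n})) (*-zeroʳ (suc d)))) z≤n
  run-invariant valid@(ins valid₀ _ _ _) (ins {s = s} {c = c} x y run ends flips settled)
    with rep , _ , paid ← run-invariant valid₀ run
    = insertion-represents valid rep ends flips , settled , insertion-paid {s = s} {c = c} valid rep paid ends flips
  run-invariant {σ = ρ ▷ del u v} valid@(del valid₀ Guv _) (del {s = s} {c} run)
    with rep , settled , paid ← run-invariant valid₀ run
    = represents-deleteEdge s u v rep (edge⇒distinct valid₀ Guv) , (λ w → ≤-trans (length-deleteEdge s u v w) (settled w)) ,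
      deletion-paid {s = s} {c} valid settled paid

  partialRun-paid : ∀ {σ : Seq n} {s : Out n} {c : ℕ} → Valid α σ → PartialRun d σ s c → Paid σ s c
  partialRun-paid valid (full run) = proj₂ (proj₂ (run-invariant valid run))
  partialRun-paid valid@(ins valid₀ _ _ _) (inIns {s = s} {c = c} x y run ends flips)
    with rep , _ , paid ← run-invariant valid₀ run
    = insertion-paid {s = s} {c = c} valid rep paid ends flips

  cost-bound : ∀ {σ : Seq n} {s : Out n} {c : ℕ} → Valid α σ → PartialRun d σ s c → c * D ≤ Budget σ
  cost-bound valid run with O , good ← goodOrientation-exists valid = ≤-trans (m≤m+n _ _) (partialRun-paid valid run O good)

theorem43 : Σ ℕ λ C →
    (d δ α n : ℕ) → 0 < α → α < δ → 2 * δ ≤ d →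
    (σ : Seq n) → Valid α σ →
    (s : Out n) (c : ℕ) → PartialRun d σ s c →
    (L : ℕ) → α ^ L * n ≤ δ ^ L →
    c * (suc d ∸ 2 * δ)
      ≤ C * (#ins σ * (δ * suc d)
             + #del σ * (d * (suc d ∸ 2 * δ) + L * suc d))
theorem43 = 4 , λ d δ α n 0<α α<δ 2δ≤d σ valid s c run L small →
  let 0<δ = <-trans 0<α α<δ
      0<d = ≤-trans 0<δ (≤-trans (m≤m+n δ (δ + 0)) 2δ≤d)
  in Amortization.cost-bound d δ α L (suc d ∸ 2 * δ) (m∸n+n≡m (m≤n⇒m≤1+n 2δ≤d)) 0<α 0<δ 0<d small valid run
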